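{- Let $k \geq 2$ and let $H=(V,E)$ be a finite $k$-uniform sequence hypergraph with $\Delta(H) \leq \Delta$ and $I(H)=I$, whose every vertex is equipped with a list of at least $R$ colors. Let $\Pi$ be a set of permutations of $\{1,\dots,k\}$ such that $\sigma\in\Pi$ implies $\sigma^{ -1}\in\Pi$, and let $\pi := |\Pi|$. Define $q_1:=1$ and $q_i:= \frac{i}{i-1}\sqrt[i]{i-1}$ for every $i > 1$. If $$R \geq 1+\left\lfloor \sum_{i \in I} q_i \sqrt[i]{\Delta(\Delta-1)\pi \left(1+ (k-1)\min \left\{1, \frac{|I|}{k-i} \right\}\right)}\right\rfloor,$$ then there exists a list $\Pi$-distinguishing coloring of $H$.
   Context: A sequence hypergraph is a hypergraph in which each edge is given as a sequence $(v_1,\dots,v_k)$ of its (distinct) vertices; orderings of different edges are independent. For a vertex $v$, $\deg v$ is the number of edges containing $v$ and $\Delta(H)=\max_v\deg v$. $I(H):=\{|P\setminus Q| : P,Q\in E\}\cap\{1,\dots,k-1\}$ (edges viewed as sets). Two sequences $B=(b_1,\dots,b_k)$ and $D=(d_1,\dots,d_k)$ are $\Pi$-compatible if there is $\sigma\in\Pi$ with $(b_{\sigma(1)},\dots,b_{\sigma(k)})=D$. A vertex coloring $\varphi$ is $\Pi$-distinguishing if for any two distinct intersecting edges $P=(p_1,\dots,p_k)$ and $Q=(q_1,\dots,q_k)$, the color sequences $(\varphi(p_1),\dots,\varphi(p_k))$ and $(\varphi(q_1),\dots,\varphi(q_k))$ are not $\Pi$-compatible. A list coloring assigns to each vertex a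 color from its list. -}

module Defs where

open import Data.Nat as ℕ using (ℕ; zero; suc; _∸_; _≤_; _<_)
open import Data.Integer using (+_)
open import Data.Rational as ℚ using (ℚ; 0ℚ; 1ℚ; _/_)
open import Data.Fin using (Fin)
open import Data.Fin.Properties using (_≟_)
open import Data.Fin.Permutation using (Permutation′; _⟨$⟩ʳ_)
open import Data.Bool using (Bool; true; false; if_then_else_; not; _∧_)
open import Data.List using (List; []; _∷_; length; filter; foldr; map; upTo; allFin)
open import Data.Bool.ListAction using (any)
open import Data.List.Membership.Propositional using (_∈_)
open import Data.Product using (Σ; ∃; _×_; _,_)
open import Relation.Nullary using (¬_)
open import Relation.Nullary.Decidable using (⌊_⌋)
open import Relation.Binary.PropositionalEquality using (_≡_; _≢_)
open import Function.Definitions using (Injective)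

record SeqHypergraph (n m k : ℕ) : Set where
  field
    edge     : Fin m → Fin k → Fin n
    distinct : ∀ e → Injective _≡_ _≡_ (edge e)
    -- E is a set of edges: distinct edges have distinct vertex sets
    simple   : ∀ e e' → e ≢ e' →
               ¬ ((∀ j → ∃ λ j' → edge e j ≡ edge e' j') ×
                  (∀ j' → ∃ λ j → edge e' j' ≡ edge e j))

count : {A : Set} → (A → Bool) → List A → ℕ
count p xs = length (filter (λ x → Data.Bool.T? (p x)) xs)
  where import Data.Bool

memB : ∀ {n k} → Fin n → (Fin k → Fin n) → Bool
memB {k = k} v P = any (λ j → ⌊ v ≟ P j ⌋) (allFin k)

module _ {n m k : ℕ} (H : SeqHypergraph n m k) where
  open SeqHypergraph H

  deg : Fin n → ℕ
  deg v = count (λ e → memB v (edge e)) (allFin m)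

  -- |P \ Q| for edges viewed as sets (entries of P are distinct)
  diffSize : Fin m → Fin m → ℕ
  diffSize e e' = count (λ j → not (memB (edge e j) (edge e'))) (allFin k)

  inI : ℕ → Bool
  inI i = ⌊ 1 ℕ.≤? i ⌋ ∧ ⌊ i ℕ.<? k ⌋ ∧
          any (λ e → any (λ e' → ⌊ diffSize e e' ℕ.≟ i ⌋) (allFin m)) (allFin m)

  sizeI : ℕ
  sizeI = count inI (upTo k)

record PermSet (k : ℕ) : Set where
  field
    perms      : List (Permutation′ k)
    -- no two entries are the same permutation (so π = |Π| = length perms)
    noDup      : ∀ {a b : Fin (length perms)} → a ≢ b →
                 ∃ λ j → (Data.List.lookup perms a ⟨$⟩ʳ j) ≢ (Data.List.lookup perms b ⟨$⟩ʳ j)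
    invClosed  : ∀ σ → σ ∈ perms → ∃ λ τ → τ ∈ perms × (∀ j → τ ⟨$⟩ʳ (σ ⟨$⟩ʳ j) ≡ j)

Compatible : ∀ {k} {C : Set} → PermSet k → (Fin k → C) → (Fin k → C) → Set
Compatible Π B D = ∃ λ σ → σ ∈ PermSet.perms Π × (∀ j → B (σ ⟨$⟩ʳ j) ≡ D j)

Distinguishing : ∀ {n m k} {C : Set} → SeqHypergraph n m k → PermSet k → (Fin n → C) → Set
Distinguishing {k = k} H Π φ =
  ∀ e e' → e ≢ e' →
  (∃ λ j → ∃ λ j' → edge e j ≡ edge e' j') →
  ¬ Compatible Π (λ j → φ (edge e j)) (λ j → φ (edge e' j))
  where open SeqHypergraph H

-- a // b = a/b for b > 0 (only used with positive denominators)
_//_ : ℕ → ℕ → ℚ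
a // zero    = 0ℚ
a // (suc b) = (+ a) / suc b

fromℕ : ℕ → ℚ
fromℕ a = a // 1

_^ℚ_ : ℚ → ℕ → ℚ
x ^ℚ zero  = 1ℚ
x ^ℚ suc i = x ℚ.* (x ^ℚ i)

sumRange : ℕ → (ℕ → ℚ) → ℚ
sumRange k r = foldr (λ i acc → r i ℚ.+ acc) 0ℚ (filter (λ i → 1 ℕ.≤? i) (upTo k))

Xterm : (Δ π k sI i : ℕ) → ℚ
Xterm Δ π k sI i =
  fromℕ (Δ ℕ.* (Δ ∸ 1) ℕ.* π) ℚ.* (1ℚ ℚ.+ fromℕ (k ∸ 1) ℚ.* (1ℚ ℚ.⊓ (sI // (k ∸ i))))

-- A_i with  q_i · X_i^{1/i} = A_i^{1/i}:
--   A_1 = X_1,   A_i = (i/(i-1))^i · (i-1) · X_i  for i > 1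
Aterm : (Δ π k sI i : ℕ) → ℚ
Aterm Δ π k sI 1 = Xterm Δ π k sI 1
Aterm Δ π k sI i = ((i // (i ∸ 1)) ^ℚ i) ℚ.* fromℕ (i ∸ 1) ℚ.* Xterm Δ π k sI i

-- R ≥ 1 + ⌊ Σ_{i∈I} q_i (X_i)^{1/i} ⌋, i.e. (R an integer)  Σ_{i∈I} q_i X_i^{1/i} < R,
-- expressed without reals: there are nonnegative rationals r_i ≥ q_i X_i^{1/i}
-- (equivalently A_i ≤ r_i^i) for i ∈ I with Σ r_i < R.
BoundHolds : ∀ {n m k} → SeqHypergraph n m k → (Δ π R : ℕ) → Set
BoundHolds {k = k} H Δ π R =
  Σ (ℕ → ℚ) λ r →
    (∀ i → 1 ≤ i → i < k → 0ℚ ℚ.≤ r i) ×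
    (∀ i → inI H i ≡ true → Aterm Δ π k (sizeI H) i ℚ.≤ (r i ^ℚ i)) ×
    (sumRange k (λ i → if inI H i then r i else 0ℚ) ℚ.< fromℕ R)

module Submission where

-- Counting in the style of Rosenfeld. For a set S of vertices let C(S) count the colourings from the lists
-- on S (a dummy colour elsewhere) with no conflict inside S, a conflict being distinct intersecting edges
-- P, Q and σ ∈ Π such that every pair p_σ(j) ≠ q_j gets equal colours and lies in S. By induction on S,
-- C(S ∪ {v}) ≥ β C(S) with β = R − Σ_{i∈I} r_i / i: of the |L(v)| C(S) extensions of conflict-free
-- colourings of S, a bad one has a conflict with v in Q at a relevant position (reversing σ, which Π allows),
-- and with i = |Q ∖ P| it is determined by its restriction to S minus i − 1 vertices of Q ∖ P, whose colours
-- are copied from P. The induction hypothesis bounds these restrictions by C(S) / β^(i−1); there are at most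
-- Δ k (Δ − 1) π / (k − i) ≤ X_i such (P, Q, σ), and (i − 1) X_i ≤ (r_i (i − 1)/i)^i ≤ β^(i − 1) r_i (i − 1)/i,
-- so the bad extensions of class i number at most (r_i / i) C(S). Since C(∅) = 1 and β > 0, C(V) > 0.

open import Data.Nat.Base using (ℕ)
import Data.Nat.Base as ℕ
open import Data.Fin.Base using (Fin)
open import Data.List.Base using (List; length)
open import Data.List.Relation.Unary.Unique.Propositional using (Unique)
open import Defs using (SeqHypergraph; PermSet; deg; BoundHolds)

module Counting where

  open import Level using (Level)
  open import Data.Bool.Base using (true; false; if_then_else_)
  open import Data.Nat.Base
  open import Data.Nat.Properties
  open import Algebra.Properties.CommutativeSemigroup +-commutativeSemigroup using (interchange)
  open import Data.List.Base using (List; []; _∷_; _++_; length; filter; map; concatMap; cartesianProductWith)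
  open import Data.List.Properties using (filter-some; filter-notAll; filter-all; length-++-sucʳ)
  import Data.List.Relation.Unary.All as All
  open import Data.List.Membership.Propositional using (_∈_; lose)
  open import Data.List.Membership.Propositional.Properties using (∈-filter⁺; ∈-filter⁻; ∈-∃++; ∈-++⁺ˡ; ∈-++⁺ʳ; ∈-++⁻)
  open import Data.List.Relation.Unary.Any using (here; there)
  open import Data.List.Relation.Unary.AllPairs using (_∷_)
  open import Data.List.Relation.Unary.All.Properties using (All¬⇒¬Any)
  open import Data.List.Relation.Unary.Unique.Propositional using (Unique)
  import Data.List.Relation.Unary.Unique.Propositional.Properties as Unique
  open import Data.Product.Base using (∃; _×_; _,_)
  open import Data.Sum.Base using (_⊎_; inj₁; inj₂)
  open import Function.Base using (_∘_)
  open import Relation.Nullary using (¬_; Dec; yes; no; does; contradiction; _×-dec_)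
  open import Relation.Unary using (Pred; Decidable)
  open import Relation.Binary.PropositionalEquality
  private variable
    a b c p q r : Level
    A : Set a
    B : Set b

  ∑ : (A → ℕ) → List A → ℕ
  ∑ f []       = 0
  ∑ f (x ∷ xs) = f x + ∑ f xs

  syntax ∑ (λ x → e) xs = ∑[ x ← xs ] e

  tally : {P : Pred A p} → Decidable P → List A → ℕ
  tally P? xs = length (filter P? xs)

  indicator : {P : Pred A p} → Decidable P → A → ℕ
  indicator P? x = if does (P? x) then 1 else 0

  ∑-cong : ∀ {f g : A → ℕ} xs → (∀ {x} → x ∈ xs → f x ≡ g x) → ∑ f xs ≡ ∑ g xs
  ∑-cong []       h = refl
  ∑-cong (x ∷ xs) h = cong₂ _+_ (h (here refl)) (∑-cong xs (h ∘ there))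

  ∑-mono : ∀ {f g : A → ℕ} xs → (∀ {x} → x ∈ xs → f x ≤ g x) → ∑ f xs ≤ ∑ g xs
  ∑-mono []       h = z≤n
  ∑-mono (x ∷ xs) h = +-mono-≤ (h (here refl)) (∑-mono xs (h ∘ there))

  ∑-+ : ∀ (f g : A → ℕ) xs → ∑[ x ← xs ] (f x + g x) ≡ ∑ f xs + ∑ g xs
  ∑-+ f g []       = refl
  ∑-+ f g (x ∷ xs) = trans (cong (f x + g x +_) (∑-+ f g xs)) (interchange (f x) (g x) (∑ f xs) (∑ g xs))

  ∑-*ˡ : ∀ c (f : A → ℕ) xs → ∑[ x ← xs ] (c * f x) ≡ c * ∑ f xs
  ∑-*ˡ c f []       = sym (*-zeroʳ c)
  ∑-*ˡ c f (x ∷ xs) = trans (cong (c * f x +_) (∑-*ˡ c f xs)) (sym (*-distribˡ-+ c (f x) _))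

  ∑-const : ∀ c (xs : List A) → ∑[ _ ← xs ] c ≡ length xs * c
  ∑-const c []       = refl
  ∑-const c (x ∷ xs) = cong (c +_) (∑-const c xs)

  ∑-++ : ∀ (f : A → ℕ) xs ys → ∑ f (xs ++ ys) ≡ ∑ f xs + ∑ f ys
  ∑-++ f []       ys = refl
  ∑-++ f (x ∷ xs) ys = trans (cong (f x +_) (∑-++ f xs ys)) (sym (+-assoc (f x) _ _))

  ∑-map : ∀ (f : A → ℕ) (g : B → A) xs → ∑ f (map g xs) ≡ ∑ (f ∘ g) xs
  ∑-map f g []       = refl
  ∑-map f g (x ∷ xs) = cong (f (g x) +_) (∑-map f g xs)

  ∑-concatMap : ∀ (f : A → ℕ) (g : B → List A) xs → ∑ f (concatMap g xs) ≡ ∑[ y ← xs ] ∑ f (g y)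
  ∑-concatMap f g []       = refl
  ∑-concatMap f g (x ∷ xs) = trans (∑-++ f (g x) (concatMap g xs)) (cong (∑ f (g x) +_) (∑-concatMap f g xs))

  ∑-cartesianProductWith : ∀ {C : Set c} (g : C → ℕ) (f : A → B → C) xs ys →
    ∑ g (cartesianProductWith f xs ys) ≡ ∑[ x ← xs ] ∑ (g ∘ f x) ys
  ∑-cartesianProductWith g f []       ys = refl
  ∑-cartesianProductWith g f (x ∷ xs) ys = begin
    ∑ g (map (f x) ys ++ cartesianProductWith f xs ys)      ≡⟨ ∑-++ g (map (f x) ys) _ ⟩
    ∑ g (map (f x) ys) + ∑ g (cartesianProductWith f xs ys) ≡⟨ cong₂ _+_ (∑-map g (f x) ys) (∑-cartesianProductWith g f xs ys) ⟩
    ∑ (g ∘ f x) ys + ∑[ x ← xs ] ∑ (g ∘ f x) ys             ∎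
    where open ≡-Reasoning

  ∑-swap : ∀ (f : A → B → ℕ) xs ys → ∑[ x ← xs ] ∑[ y ← ys ] f x y ≡ ∑[ y ← ys ] ∑[ x ← xs ] f x y
  ∑-swap f []       ys = sym (trans (∑-const 0 ys) (*-zeroʳ (length ys)))
  ∑-swap f (x ∷ xs) ys = begin
    ∑ (f x) ys + ∑[ x ← xs ] ∑ (f x) ys               ≡⟨ cong (∑ (f x) ys +_) (∑-swap f xs ys) ⟩
    ∑ (f x) ys + ∑[ y ← ys ] ∑[ x ← xs ] f x y        ≡⟨ ∑-+ (f x) (λ y → ∑[ x ← xs ] f x y) ys ⟨
    ∑[ y ← ys ] (f x y + ∑[ x ← xs ] f x y)           ∎
    where open ≡-Reasoning

  ∑-≥-term : ∀ (f : A → ℕ) {x xs} → x ∈ xs → f x ≤ ∑ f xs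
  ∑-≥-term f (here refl) = m≤m+n _ _
  ∑-≥-term f {xs = y ∷ _} (there x∈) = ≤-trans (∑-≥-term f x∈) (m≤n+m _ (f y))

  if-does-≤ : ∀ {P : Set p} (d : Dec P) {m n} → (P → m ≤ n) → (if does d then m else 0) ≤ n
  if-does-≤ (yes p) h = h p
  if-does-≤ (no _)  h = z≤n

  module _ {P : Pred A p} (P? : Decidable P) where

    tally≡∑indicator : ∀ xs → tally P? xs ≡ ∑ (indicator P?) xs
    tally≡∑indicator []       = refl
    tally≡∑indicator (x ∷ xs) with does (P? x)
    ... | true  = cong suc (tally≡∑indicator xs)
    ... | false = tally≡∑indicator xs

    ∑-indicator-* : ∀ c xs → ∑[ x ← xs ] (if does (P? x) then c else 0) ≡ tally P? xs * c
    ∑-indicator-* c []       = refl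
    ∑-indicator-* c (x ∷ xs) with does (P? x)
    ... | true  = cong (c +_) (∑-indicator-* c xs)
    ... | false = ∑-indicator-* c xs

  tally-const : ∀ {X : Set p} (d : Dec X) (xs : List A) → tally (λ _ → d) xs ≡ (if does d then length xs else 0)
  tally-const (yes _) []       = refl
  tally-const (no _)  []       = refl
  tally-const (yes x) (_ ∷ xs) = cong suc (tally-const (yes x) xs)
  tally-const (no ¬x) (_ ∷ xs) = tally-const (no ¬x) xs

  tally-×-dec-const : ∀ {X : Set p} {Q : Pred A q} (d : Dec X) (Q? : Decidable Q) xs →
    tally (λ x → d ×-dec Q? x) xs ≡ (if does d then tally Q? xs else 0)
  tally-×-dec-const (no ¬x) Q? []       = refl
  tally-×-dec-const (yes x) Q? []       = refl
  tally-×-dec-const (no ¬x) Q? (_ ∷ xs) = tally-×-dec-const (no ¬x) Q? xs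
  tally-×-dec-const (yes x) Q? (y ∷ xs) with does (Q? y)
  ... | true  = cong suc (tally-×-dec-const (yes x) Q? xs)
  ... | false = tally-×-dec-const (yes x) Q? xs

  module _ {P : Pred A p} (P? : Decidable P) where

    indicator-≥1 : ∀ {x} → P x → 1 ≤ indicator P? x
    indicator-≥1 {x} px with P? x
    ... | yes _ = ≤-refl
    ... | no ¬p = contradiction px ¬p

    tally-cartesianProductWith : ∀ {C : Set c} (f : B → C → A) xs ys →
      tally P? (cartesianProductWith f xs ys) ≡ ∑[ x ← xs ] tally (P? ∘ f x) ys
    tally-cartesianProductWith f xs ys = begin
      tally P? (cartesianProductWith f xs ys)             ≡⟨ tally≡∑indicator P? (cartesianProductWith f xs ys) ⟩
      ∑ (indicator P?) (cartesianProductWith f xs ys)     ≡⟨ ∑-cartesianProductWith (indicator P?) f xs ys ⟩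
      ∑[ x ← xs ] ∑ (indicator (P? ∘ f x)) ys             ≡⟨ ∑-cong xs (λ {x} _ → tally≡∑indicator (P? ∘ f x) ys) ⟨
      ∑[ x ← xs ] tally (P? ∘ f x) ys                     ∎
      where open ≡-Reasoning

    tally-universal : (∀ x → P x) → ∀ xs → tally P? xs ≡ length xs
    tally-universal all xs = cong length (filter-all P? (All.universal all xs))

    tally-≥1 : ∀ {x xs} → x ∈ xs → P x → 1 ≤ tally P? xs
    tally-≥1 x∈ px = filter-some P? (lose x∈ px)

    tally-<-length : ∀ {x xs} → x ∈ xs → ¬ P x → tally P? xs < length xs
    tally-<-length x∈ ¬px = filter-notAll P? _ (lose x∈ ¬px)

    tally-witness : ∀ xs → 1 ≤ tally P? xs → ∃ λ x → x ∈ xs × P x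
    tally-witness xs h with filter P? xs in eq
    ... | x ∷ _ = x , ∈-filter⁻ P? (subst (x ∈_) (sym eq) (here refl))

  module _ {P : Pred A p} {Q : Pred A q} (P? : Decidable P) (Q? : Decidable Q) where

    indicator-mono : ∀ {x} → (P x → Q x) → indicator P? x ≤ indicator Q? x
    indicator-mono {x} h with P? x | Q? x
    ... | yes px | yes _  = ≤-refl
    ... | yes px | no ¬qx = contradiction (h px) ¬qx
    ... | no _   | _      = z≤n

    tally-mono : ∀ xs → (∀ {x} → x ∈ xs → P x → Q x) → tally P? xs ≤ tally Q? xs
    tally-mono xs h = begin
      tally P? xs            ≡⟨ tally≡∑indicator P? xs ⟩
      ∑ (indicator P?) xs    ≤⟨ ∑-mono xs (λ x∈ → indicator-mono (h x∈)) ⟩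
      ∑ (indicator Q?) xs    ≡⟨ tally≡∑indicator Q? xs ⟨
      tally Q? xs            ∎
      where open ≤-Reasoning

  module _ {P : Pred A p} {Q : Pred A q} {R : Pred A r}
           (P? : Decidable P) (Q? : Decidable Q) (R? : Decidable R) where

    tally-split : ∀ xs → (∀ {x} → x ∈ xs → P x → Q x ⊎ R x) → tally P? xs ≤ tally Q? xs + tally R? xs
    tally-split xs h = begin
      tally P? xs                                   ≡⟨ tally≡∑indicator P? xs ⟩
      ∑ (indicator P?) xs                           ≤⟨ ∑-mono xs (λ x∈ → split (h x∈)) ⟩
      ∑[ x ← xs ] (indicator Q? x + indicator R? x) ≡⟨ ∑-+ (indicator Q?) (indicator R?) xs ⟩
      ∑ (indicator Q?) xs + ∑ (indicator R?) xs     ≡⟨ cong₂ _+_ (tally≡∑indicator Q? xs) (tally≡∑indicator R? xs) ⟨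
      tally Q? xs + tally R? xs                     ∎
      where
      open ≤-Reasoning
      split : ∀ {x} → (P x → Q x ⊎ R x) → indicator P? x ≤ indicator Q? x + indicator R? x
      split {x} h with P? x | Q? x | R? x
      ... | no _  | _     | _     = z≤n
      ... | yes _ | yes _ | _     = s≤s z≤n
      ... | yes _ | no _  | yes _ = s≤s z≤n
      ... | yes p | no ¬q | no ¬r with h p
      ...   | inj₁ q = contradiction q ¬q
      ...   | inj₂ r = contradiction r ¬r

    tally-disjoint : ∀ xs → (∀ {x} → Q x → P x) → (∀ {x} → R x → P x) → (∀ {x} → Q x → ¬ R x) →
                     tally Q? xs + tally R? xs ≤ tally P? xs
    tally-disjoint xs q⇒p r⇒p q⇒¬r = begin
      tally Q? xs + tally R? xs                     ≡⟨ cong₂ _+_ (tally≡∑indicator Q? xs) (tally≡∑indicator R? xs) ⟩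
      ∑ (indicator Q?) xs + ∑ (indicator R?) xs     ≡⟨ ∑-+ (indicator Q?) (indicator R?) xs ⟨
      ∑[ x ← xs ] (indicator Q? x + indicator R? x) ≤⟨ ∑-mono xs (λ {x} _ → merge x) ⟩
      ∑ (indicator P?) xs                           ≡⟨ tally≡∑indicator P? xs ⟨
      tally P? xs                                   ∎
      where
      open ≤-Reasoning
      merge : ∀ x → indicator Q? x + indicator R? x ≤ indicator P? x
      merge x with Q? x | R? x | P? x
      ... | yes q | yes r | _     = contradiction r (q⇒¬r q)
      ... | yes q | no _  | yes _ = ≤-refl
      ... | yes q | no _  | no ¬p = contradiction (q⇒p q) ¬p
      ... | no _  | yes _ | yes _ = ≤-refl
      ... | no _  | yes r | no ¬p = contradiction (r⇒p r) ¬p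
      ... | no _  | no _  | _     = z≤n

  module _ {T : Set c} {P : Pred A p} {Q : T → Pred A q} (P? : Decidable P) (Q? : ∀ t → Decidable (Q t)) where

    tally-union : ∀ ts xs → (∀ {x} → x ∈ xs → P x → ∃ λ t → t ∈ ts × Q t x) →
                  tally P? xs ≤ ∑[ t ← ts ] tally (Q? t) xs
    tally-union ts xs h = begin
      tally P? xs                                    ≡⟨ tally≡∑indicator P? xs ⟩
      ∑ (indicator P?) xs                            ≤⟨ ∑-mono xs (λ x∈ → covered (h x∈)) ⟩
      ∑[ x ← xs ] ∑[ t ← ts ] indicator (Q? t) x     ≡⟨ ∑-swap (λ x t → indicator (Q? t) x) xs ts ⟩
      ∑[ t ← ts ] ∑ (indicator (Q? t)) xs            ≡⟨ ∑-cong ts (λ {t} _ → tally≡∑indicator (Q? t) xs) ⟨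
      ∑[ t ← ts ] tally (Q? t) xs                    ∎
      where
      open ≤-Reasoning
      covered : ∀ {x} → (P x → ∃ λ t → t ∈ ts × Q t x) → indicator P? x ≤ ∑[ t ← ts ] indicator (Q? t) x
      covered {x} h with P? x
      ... | no _  = z≤n
      ... | yes p with h p
      ...   | t , t∈ , qt = ≤-trans (indicator-≥1 (Q? t) qt) (∑-≥-term (λ t → indicator (Q? t) x) t∈)

  unique-injection-length : (f : A → B) {xs : List A} {ys : List B} → Unique xs →
    (∀ {x} → x ∈ xs → f x ∈ ys) → (∀ {x y} → x ∈ xs → y ∈ xs → f x ≡ f y → x ≡ y) →
    length xs ≤ length ys
  unique-injection-length f {[]} u into inj = z≤n
  unique-injection-length f {x ∷ xs} (x∉xs ∷ u) into inj with ∈-∃++ (into (here refl))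
  ... | ys₁ , ys₂ , refl = begin
    suc (length xs)           ≤⟨ s≤s (unique-injection-length f u into′ (λ a b → inj (there a) (there b))) ⟩
    suc (length (ys₁ ++ ys₂)) ≡⟨ length-++-sucʳ ys₁ (f x) ys₂ ⟨
    length (ys₁ ++ f x ∷ ys₂) ∎
    where
    open ≤-Reasoning
    fy≢fx : ∀ {y} → y ∈ xs → f y ≢ f x
    fy≢fx y∈ fy≡fx = All¬⇒¬Any x∉xs (subst (_∈ xs) (inj (there y∈) (here refl) fy≡fx) y∈)
    into′ : ∀ {y} → y ∈ xs → f y ∈ ys₁ ++ ys₂
    into′ y∈ with ∈-++⁻ ys₁ (into (there y∈))
    ... | inj₁ in₁         = ∈-++⁺ˡ in₁
    ... | inj₂ (here eq)   = contradiction eq (fy≢fx y∈)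
    ... | inj₂ (there in₂) = ∈-++⁺ʳ ys₁ in₂

  module _ {P : Pred A p} {Q : Pred B q} (P? : Decidable P) (Q? : Decidable Q) where

    tally-injection : (f : A → B) {xs : List A} (ys : List B) → Unique xs →
      (∀ {x} → x ∈ xs → P x → f x ∈ ys × Q (f x)) →
      (∀ {x y} → x ∈ xs → y ∈ xs → P x → P y → f x ≡ f y → x ≡ y) →
      tally P? xs ≤ tally Q? ys
    tally-injection f ys u into inj = unique-injection-length f (Unique.filter⁺ P? u)
      (λ x∈ → let (x∈xs , px) = ∈-filter⁻ P? x∈ ; (fx∈ys , qfx) = into x∈xs px in ∈-filter⁺ Q? fx∈ys qfx)
      (λ x∈ y∈ → let (x∈xs , px) = ∈-filter⁻ P? x∈ ; (y∈xs , py) = ∈-filter⁻ P? y∈ in inj x∈xs y∈xs px py)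

module Assignments where

  open import Level using (Level)
  open import Data.Nat.Base using (ℕ; zero; suc; _*_)
  open import Data.Nat.Properties using (+-identityʳ)
  open import Data.Fin.Base using (Fin; zero; suc)
  open import Data.Fin.Properties using (suc-injective)
  open import Data.Vec.Base using (Vec; []; _∷_; lookup; _[_]≔_)
  open import Data.Vec.Properties using (∷-injective; tabulate∘lookup; tabulate-cong)
  open import Data.List.Base using (List; []; _∷_; [_]; length; cartesianProductWith)
  open import Data.List.Membership.Propositional using (_∈_)
  open import Data.List.Membership.Propositional.Properties using (∈-cartesianProductWith⁺; ∈-cartesianProductWith⁻)
  open import Data.List.Relation.Unary.Any using (here)
  open import Data.List.Relation.Unary.Unique.Propositional using (Unique)
  import Data.List.Relation.Unary.All as All
  import Data.List.Relation.Unary.AllPairs as AllPairs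
  import Data.List.Relation.Unary.Unique.Propositional.Properties as Unique
  open import Data.Product.Base using (_,_)
  open import Function.Base using (_∘_)
  open import Relation.Nullary using (¬_)
  open import Relation.Unary using (Decidable)
  open import Relation.Binary.PropositionalEquality using (_≡_; refl; sym; trans; cong; cong₂; module ≡-Reasoning)
  open Counting

  private variable
    a p : Level
    A : Set a
    n : ℕ

  assignments : (Fin n → List A) → List (Vec A n)
  assignments {n = zero}  options = [ [] ]
  assignments {n = suc n} options = cartesianProductWith _∷_ (options zero) (assignments (options ∘ suc))

  ∈-assignments⁺ : (options : Fin n → List A) {ψ : Vec A n} → (∀ x → lookup ψ x ∈ options x) → ψ ∈ assignments options
  ∈-assignments⁺ options {[]}    h = here refl
  ∈-assignments⁺ options {c ∷ ψ} h = ∈-cartesianProductWith⁺ _∷_ (h zero) (∈-assignments⁺ (options ∘ suc) (h ∘ suc))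

  ∈-assignments⁻ : (options : Fin n → List A) {ψ : Vec A n} → ψ ∈ assignments options → ∀ x → lookup ψ x ∈ options x
  ∈-assignments⁻ options {c ∷ ψ} ψ∈ x
    with _ , _ , c∈ , ψ∈′ , refl ← ∈-cartesianProductWith⁻ _∷_ (options zero) _ ψ∈
    with x
  ... | zero  = c∈
  ... | suc x = ∈-assignments⁻ (options ∘ suc) ψ∈′ x

  assignments-unique : (options : Fin n → List A) → (∀ x → Unique (options x)) → Unique (assignments options)
  assignments-unique {n = zero}  options u = All.[] AllPairs.∷ AllPairs.[]
  assignments-unique {n = suc n} options u =
    Unique.cartesianProductWith⁺ _∷_ ∷-injective (u zero) (assignments-unique (options ∘ suc) (u ∘ suc))

  assignments-cong : {options options′ : Fin n → List A} → (∀ x → options x ≡ options′ x) →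
                     assignments options ≡ assignments options′
  assignments-cong {n = zero}  h = refl
  assignments-cong {n = suc n} h = cong₂ (cartesianProductWith _∷_) (h zero) (assignments-cong (h ∘ suc))

  tally-free-coordinate : ∀ {P : Vec A n → Set p} (P? : Decidable P) (v : Fin n) (d : A) (options options′ : Fin n → List A) →
    options v ≡ [ d ] → (∀ x → ¬ x ≡ v → options x ≡ options′ x) →
    tally (P? ∘ (_[ v ]≔ d)) (assignments options′) ≡ length (options′ v) * tally P? (assignments options)
  tally-free-coordinate {n = suc n} P? zero d options options′ fixed same = begin
    tally (P? ∘ (_[ zero ]≔ d)) (assignments options′)
      ≡⟨ tally-cartesianProductWith (P? ∘ (_[ zero ]≔ d)) _∷_ (options′ zero) _ ⟩
    ∑[ c ← options′ zero ] tally (P? ∘ (d ∷_)) (assignments (options′ ∘ suc))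
      ≡⟨ ∑-const _ (options′ zero) ⟩
    length (options′ zero) * tally (P? ∘ (d ∷_)) (assignments (options′ ∘ suc))
      ≡⟨ cong (λ A → length (options′ zero) * tally (P? ∘ (d ∷_)) A) (assignments-cong (λ x → same (suc x) λ ())) ⟨
    length (options′ zero) * tally (P? ∘ (d ∷_)) (assignments (options ∘ suc))
      ≡⟨ cong (length (options′ zero) *_) (+-identityʳ _) ⟨
    length (options′ zero) * ∑[ c ← [ d ] ] tally (P? ∘ (c ∷_)) (assignments (options ∘ suc))
      ≡⟨ cong (λ cs → length (options′ zero) * ∑[ c ← cs ] tally (P? ∘ (c ∷_)) (assignments (options ∘ suc))) fixed ⟨
    length (options′ zero) * ∑[ c ← options zero ] tally (P? ∘ (c ∷_)) (assignments (options ∘ suc))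
      ≡⟨ cong (length (options′ zero) *_) (tally-cartesianProductWith P? _∷_ (options zero) _) ⟨
    length (options′ zero) * tally P? (assignments options) ∎
    where open ≡-Reasoning
  tally-free-coordinate {n = suc n} P? (suc v) d options options′ fixed same = begin
    tally (P? ∘ (_[ suc v ]≔ d)) (assignments options′)
      ≡⟨ tally-cartesianProductWith (P? ∘ (_[ suc v ]≔ d)) _∷_ (options′ zero) _ ⟩
    ∑[ c ← options′ zero ] tally (P? ∘ (c ∷_) ∘ (_[ v ]≔ d)) (assignments (options′ ∘ suc))
      ≡⟨ ∑-cong (options′ zero) (λ {c} _ → tally-free-coordinate (P? ∘ (c ∷_)) v d (options ∘ suc) (options′ ∘ suc) fixed
                                             (λ x x≢v → same (suc x) (x≢v ∘ suc-injective))) ⟩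
    ∑[ c ← options′ zero ] (length (options′ (suc v)) * tally (P? ∘ (c ∷_)) (assignments (options ∘ suc)))
      ≡⟨ ∑-*ˡ (length (options′ (suc v))) _ (options′ zero) ⟩
    length (options′ (suc v)) * ∑[ c ← options′ zero ] tally (P? ∘ (c ∷_)) (assignments (options ∘ suc))
      ≡⟨ cong (λ cs → length (options′ (suc v)) * ∑[ c ← cs ] tally (P? ∘ (c ∷_)) (assignments (options ∘ suc))) (same zero λ ()) ⟨
    length (options′ (suc v)) * ∑[ c ← options zero ] tally (P? ∘ (c ∷_)) (assignments (options ∘ suc))
      ≡⟨ cong (length (options′ (suc v)) *_) (tally-cartesianProductWith P? _∷_ (options zero) _) ⟨
    length (options′ (suc v)) * tally P? (assignments options) ∎
    where open ≡-Reasoning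

  lookup-extensional : ∀ {ψ φ : Vec A n} → (∀ x → lookup ψ x ≡ lookup φ x) → ψ ≡ φ
  lookup-extensional {ψ = ψ} {φ} same = trans (sym (tabulate∘lookup ψ)) (trans (tabulate-cong same) (tabulate∘lookup φ))

module Subsets where

  open import Level using (Level)
  open import Data.Nat.Base using (ℕ; suc; _≤_; s≤s; z≤n)
  open import Data.Fin.Base using (Fin; zero)
  import Data.Fin.Properties as Fin
  open import Data.Fin.Subset using (Subset; _─_; _∪_; ⁅_⁆; inside; outside; _⊆_)
    renaming (_∈_ to _∈ˢ_; _∉_ to _∉ˢ_)
  open import Data.Fin.Subset.Properties
    using (x∈p∪q⁻; x∈p∪q⁺; x∈⁅x⁆; x∈⁅y⁆⇒x≡y; x∈p∧x∉q⇒x∈p─q; p─q⊆p; x≢y⇒x∉⁅y⁆; ⊆-antisym)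
  open import Data.List.Base using (List; []; _∷_; length; foldr)
  open import Data.List.Membership.Propositional using (_∈_; _∉_)
  open import Data.List.Relation.Unary.Any using (here; there)
  open import Data.List.Relation.Unary.All.Properties using (All¬⇒¬Any)
  open import Data.List.Relation.Unary.AllPairs using (_∷_)
  open import Data.List.Relation.Unary.Unique.Propositional using (Unique)
  open import Data.Vec.Base using (_∷_)
  open import Data.Product.Base using (_×_; _,_; proj₁)
  open import Data.Sum.Base using (_⊎_; inj₁; inj₂)
  import Data.Sum.Base as Sum
  import Data.List.Relation.Unary.All as All
  open import Function.Base using (_∘_)
  open import Relation.Nullary using (yes; no)
  open import Relation.Binary.Definitions using (DecidableEquality)
  open import Relation.Binary.PropositionalEquality using (_≡_; refl; sym; cong; subst)
  import Data.Vec.Base as Vec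

  private variable
    a : Level
    A : Set a
    n : ℕ

  x∈p─q⇒x∉q : ∀ {x : Fin n} (p q : Subset n) → x ∈ˢ p ─ q → x ∉ˢ q
  x∈p─q⇒x∉q (inside  ∷ p) (outside ∷ q) Vec.here       = λ ()
  x∈p─q⇒x∉q {x = zero} (inside  ∷ p) (inside  ∷ q) ()
  x∈p─q⇒x∉q {x = zero} (outside ∷ p) (inside  ∷ q) ()
  x∈p─q⇒x∉q {x = zero} (outside ∷ p) (outside ∷ q) ()
  x∈p─q⇒x∉q (s       ∷ p) (t       ∷ q) (Vec.there x∈) = λ { (Vec.there x∈q) → x∈p─q⇒x∉q p q x∈ x∈q }

  insertAll : Subset n → List (Fin n) → Subset n
  insertAll = foldr (λ w B → B ∪ ⁅ w ⁆)

  removeAll : Subset n → List (Fin n) → Subset n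
  removeAll = foldr (λ w S → S ─ ⁅ w ⁆)

  ∈-insertAll⁺ˡ : ∀ {B : Subset n} {x} ws → x ∈ˢ B → x ∈ˢ insertAll B ws
  ∈-insertAll⁺ˡ []       x∈B = x∈B
  ∈-insertAll⁺ˡ (w ∷ ws) x∈B = x∈p∪q⁺ (inj₁ (∈-insertAll⁺ˡ ws x∈B))

  ∈-insertAll⁺ʳ : ∀ {B : Subset n} {x ws} → x ∈ ws → x ∈ˢ insertAll B ws
  ∈-insertAll⁺ʳ               (here refl) = x∈p∪q⁺ (inj₂ (x∈⁅x⁆ _))
  ∈-insertAll⁺ʳ {ws = _ ∷ ws} (there x∈)  = x∈p∪q⁺ (inj₁ (∈-insertAll⁺ʳ x∈))

  ∈-insertAll⁻ : ∀ (B : Subset n) ws {x} → x ∈ˢ insertAll B ws → x ∈ˢ B ⊎ x ∈ ws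
  ∈-insertAll⁻ B []       x∈ = inj₁ x∈
  ∈-insertAll⁻ B (w ∷ ws) x∈ with x∈p∪q⁻ (insertAll B ws) ⁅ w ⁆ x∈
  ... | inj₁ x∈′ = Sum.map₂ there (∈-insertAll⁻ B ws x∈′)
  ... | inj₂ x∈w = inj₂ (here (x∈⁅y⁆⇒x≡y w x∈w))

  ∈-removeAll⁺ : ∀ (S : Subset n) ws {x} → x ∈ˢ S → x ∉ ws → x ∈ˢ removeAll S ws
  ∈-removeAll⁺ S []       x∈S x∉ws = x∈S
  ∈-removeAll⁺ S (w ∷ ws) x∈S x∉ws = x∈p∧x∉q⇒x∈p─q (∈-removeAll⁺ S ws x∈S (x∉ws ∘ there)) (x≢y⇒x∉⁅y⁆ (x∉ws ∘ here))

  ∈-removeAll⁻ : ∀ (S : Subset n) ws {x} → x ∈ˢ removeAll S ws → x ∈ˢ S × x ∉ ws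
  ∈-removeAll⁻ S []       x∈ = x∈ , λ ()
  ∈-removeAll⁻ S (w ∷ ws) x∈ with ∈-removeAll⁻ S ws (p─q⊆p _ ⁅ w ⁆ x∈)
  ... | x∈S , x∉ws = x∈S , λ where
    (here refl)  → x∈p─q⇒x∉q _ ⁅ w ⁆ x∈ (x∈⁅x⁆ w)
    (there x∈ws) → x∉ws x∈ws

  insertAll-removeAll : ∀ (S : Subset n) ws → (∀ {w} → w ∈ ws → w ∈ˢ S) → insertAll (removeAll S ws) ws ≡ S
  insertAll-removeAll {n} S ws ws⊆S = ⊆-antisym ⊆S S⊆
    where
    open import Data.List.Membership.DecPropositional (Fin._≟_ {n}) using () renaming (_∈?_ to _∈ˡ?_)
    ⊆S : insertAll (removeAll S ws) ws ⊆ S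
    ⊆S x∈ with ∈-insertAll⁻ (removeAll S ws) ws x∈
    ... | inj₁ x∈S−ws = proj₁ (∈-removeAll⁻ S ws x∈S−ws)
    ... | inj₂ x∈ws   = ws⊆S x∈ws
    S⊆ : S ⊆ insertAll (removeAll S ws) ws
    S⊆ {x} x∈S with x ∈ˡ? ws
    ... | yes x∈ws = ∈-insertAll⁺ʳ x∈ws
    ... | no x∉ws  = ∈-insertAll⁺ˡ ws (∈-removeAll⁺ S ws x∈S x∉ws)

  module _ {A : Set a} (_≟_ : DecidableEquality A) where
    open import Data.List.Membership.DecPropositional _≟_ using (_∈?_)

    removeOrDrop : A → List A → List A
    removeOrDrop v []       = []
    removeOrDrop v (x ∷ xs) with x ≟ v | v ∈? xs
    ... | yes _ | _     = xs
    ... | no _  | yes _ = x ∷ removeOrDrop v xs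
    ... | no _  | no _  = xs

    removeOrDrop-⊆ : ∀ v xs {y} → y ∈ removeOrDrop v xs → y ∈ xs
    removeOrDrop-⊆ v (x ∷ xs) y∈ with x ≟ v | v ∈? xs
    ... | yes _ | _     = there y∈
    ... | no _  | no _  = there y∈
    ... | no _  | yes _ with y∈
    ...   | here y≡x   = here y≡x
    ...   | there y∈′  = there (removeOrDrop-⊆ v xs y∈′)

    removeOrDrop-unique : ∀ v {xs} → Unique xs → Unique (removeOrDrop v xs)
    removeOrDrop-unique v {[]}     u            = u
    removeOrDrop-unique v {x ∷ xs} (x∉xs ∷ u) with x ≟ v | v ∈? xs
    ... | yes _ | _     = u
    ... | no _  | no _  = u
    ... | no _  | yes _ = All.tabulate (λ y∈ x≡y → All¬⇒¬Any x∉xs (subst (_∈ xs) (sym x≡y) (removeOrDrop-⊆ v xs y∈)))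
                          ∷ removeOrDrop-unique v u

    v∉removeOrDrop : ∀ v {xs} → Unique xs → v ∉ removeOrDrop v xs
    v∉removeOrDrop v {x ∷ xs} (x∉xs ∷ u) with x ≟ v | v ∈? xs
    ... | yes refl | _      = All¬⇒¬Any x∉xs
    ... | no _     | no v∉  = v∉
    ... | no x≢v   | yes _  = λ where
      (here v≡x)  → x≢v (sym v≡x)
      (there v∈)  → v∉removeOrDrop v u v∈

    length-removeOrDrop : ∀ v {xs} → 1 ≤ length xs → suc (length (removeOrDrop v xs)) ≡ length xs
    length-removeOrDrop v {x ∷ xs} _ with x ≟ v | v ∈? xs
    ... | yes _ | _     = refl
    ... | no _  | no _  = refl
    ... | no _  | yes v∈ with xs
    ...   | _ ∷ _ = cong suc (length-removeOrDrop v (s≤s z≤n))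

module Hypergraph where

  open import Data.Bool.Base using (true; false; T; not; if_then_else_)
  open import Data.Bool.Properties using (T?; T-≡; T-∧)
  open import Function.Bundles using (module Equivalence)
  open import Data.Bool.ListAction using (any)
  open import Data.Nat.Base as ℕ using (ℕ; suc; _+_; _*_; _∸_; _≤_; _<_)
  open import Data.Nat.Properties as ℕ using (n<1+n; +-monoʳ-≤; m+n≤o⇒m≤o∸n; m≤n+o⇒m∸n≤o)
  open import Data.Fin.Base using (Fin; punchOut)
  open import Data.Fin.Properties using (_≟_; any?; punchOut-injective; <⇒notInjective)
  open import Data.List.Base using (List; map; filter; length; allFin)
  open import Data.List.Properties using (length-map; length-tabulate)
  import Data.Sum.Base as Sum
  open import Data.List.Membership.Propositional using (_∈_; lose)
  open import Data.List.Membership.Propositional.Properties using (∈-allFin; ∈-map⁻; ∈-filter⁻; ∈-upTo⁺)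
  open import Data.List.Relation.Unary.Any using (satisfied)
  open import Data.List.Relation.Unary.Any.Properties using (any⁺; any⁻)
  open import Data.List.Relation.Unary.Unique.Propositional using (Unique)
  import Data.List.Relation.Unary.Unique.Propositional.Properties as Unique
  open import Data.Product.Base using (∃; _×_; _,_; proj₁; proj₂)
  open import Function.Base using (_∘_)
  open import Data.Unit.Base using (⊤; tt)
  open import Function.Definitions using (Injective)
  open import Relation.Nullary using (¬_; Dec; yes; no; does; contradiction; ¬?; _×-dec_)
  import Relation.Nullary.Decidable as Dec
  open import Relation.Nullary.Decidable using (⌊_⌋; toWitness; fromWitness)
  open import Relation.Binary.PropositionalEquality using (_≡_; _≢_; refl; sym; trans; cong; subst)
  open import Defs
  open Counting

  T-not⁻ : ∀ {b} → T (not b) → ¬ T b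
  T-not⁻ {false} _ ()

  T-not⁺ : ∀ {b} → ¬ T b → T (not b)
  T-not⁺ {true}  ¬t = ¬t _
  T-not⁺ {false} _  = _

  length-allFin : ∀ k → length (allFin k) ≡ k
  length-allFin k = length-tabulate {n = k} (λ i → i)

  injective⇒surjective : ∀ {p} (f : Fin p → Fin p) → Injective _≡_ _≡_ f → ∀ y → ∃ λ x → f x ≡ y
  injective⇒surjective {suc p} f inj y with any? (λ x → f x ≟ y)
  ... | yes found = found
  ... | no ¬found = contradiction (λ {a b} → ginj {a} {b}) (<⇒notInjective (n<1+n p))
    where
    g : Fin (suc p) → Fin p
    g x = punchOut (λ y≡fx → ¬found (x , sym y≡fx))
    ginj : Injective _≡_ _≡_ g
    ginj {a} {b} = inj ∘ punchOut-injective (λ y≡fa → ¬found (a , sym y≡fa)) (λ y≡fb → ¬found (b , sym y≡fb))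

  module _ {n k : ℕ} {x : Fin n} {P : Fin k → Fin n} where

    T-memB⁻ : T (memB x P) → ∃ λ j → x ≡ P j
    T-memB⁻ t with j , x≟Pj ← satisfied (any⁻ _ (allFin k) t) = j , toWitness x≟Pj

    T-memB⁺ : ∀ {j} → x ≡ P j → T (memB x P)
    T-memB⁺ {j} x≡Pj = any⁺ _ (lose (∈-allFin j) (fromWitness x≡Pj))

  module _ {n m k : ℕ} (H : SeqHypergraph n m k) where
    open SeqHypergraph H

    Intersecting : Fin m → Fin m → Set
    Intersecting e e′ = ∃ λ j → ∃ λ j′ → edge e j ≡ edge e′ j′

    intersecting-sym : ∀ {e e′} → Intersecting e e′ → Intersecting e′ e
    intersecting-sym (j , j′ , eq) = j′ , j , sym eq

    outside? : ∀ e′ e j → Dec (T (not (memB (edge e′ j) (edge e))))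
    outside? e′ e j = T? (not (memB (edge e′ j) (edge e)))

    difference : Fin m → Fin m → List (Fin n)
    difference e′ e = map (edge e′) (filter (outside? e′ e) (allFin k))

    length-difference : ∀ e′ e → length (difference e′ e) ≡ diffSize H e′ e
    length-difference e′ e = length-map (edge e′) (filter (outside? e′ e) (allFin k))

    difference-unique : ∀ e′ e → Unique (difference e′ e)
    difference-unique e′ e = Unique.map⁺ (distinct e′) (Unique.filter⁺ _ (Unique.allFin⁺ k))

    ∈-difference⁻ : ∀ {e′ e x} → x ∈ difference e′ e → (∃ λ j → x ≡ edge e′ j) × (∀ j → x ≢ edge e j)
    ∈-difference⁻ {e′} {e} x∈ with ∈-map⁻ (edge e′) x∈
    ... | j , j∈ , refl = (j , refl) , λ i x≡ → T-not⁻ (proj₂ (∈-filter⁻ (outside? e′ e) {xs = allFin k} j∈)) (T-memB⁺ {P = edge e} x≡)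

    diffSize-pos : ∀ {e e′} → e ≢ e′ → 1 ≤ diffSize H e′ e
    diffSize-pos {e} {e′} e≢e′ with 1 ℕ.≤? diffSize H e′ e
    ... | yes pos = pos
    ... | no ¬pos = contradiction (e⊆e′ , inside) (simple e e′ e≢e′)
      where
      inside : ∀ j′ → ∃ λ j → edge e′ j′ ≡ edge e j
      inside j′ with T? (memB (edge e′ j′) (edge e))
      ... | yes t = T-memB⁻ t
      ... | no ¬t = contradiction (tally-≥1 (outside? e′ e) (∈-allFin j′) (T-not⁺ ¬t)) ¬pos
      f : Fin k → Fin k
      f = proj₁ ∘ inside
      f-injective : Injective _≡_ _≡_ f
      f-injective {a} {b} fa≡fb = distinct e′ (trans (proj₂ (inside a)) (trans (cong (edge e) fa≡fb) (sym (proj₂ (inside b)))))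
      e⊆e′ : ∀ j → ∃ λ j′ → edge e j ≡ edge e′ j′
      e⊆e′ j with j′ , fj′≡j ← injective⇒surjective f f-injective j =
        j′ , trans (cong (edge e) (sym fj′≡j)) (sym (proj₂ (inside j′)))

    diffSize-< : ∀ {e e′ j j′} → edge e j ≡ edge e′ j′ → diffSize H e′ e < k
    diffSize-< {e} {e′} {j} {j′} eq = subst (diffSize H e′ e <_) (length-allFin k)
      (tally-<-length (outside? e′ e) (∈-allFin j′) (λ t → T-not⁻ t (T-memB⁺ {P = edge e} (sym eq))))

    inI-intro : ∀ {i e e′} → 1 ≤ i → i < k → diffSize H e e′ ≡ i → inI H i ≡ true
    inI-intro {i} {e} {e′} 1≤i i<k ds≡i = Equivalence.to T-≡
      (Equivalence.from (T-∧ {⌊ 1 ℕ.≤? i ⌋}) (fromWitness 1≤i , Equivalence.from (T-∧ {⌊ i ℕ.<? k ⌋}) (fromWitness i<k , realised)))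
      where
      realised : T (any (λ e → any (λ e′ → ⌊ diffSize H e e′ ℕ.≟ i ⌋) (allFin m)) (allFin m))
      realised = any⁺ (λ e → any (λ e′ → ⌊ diffSize H e e′ ℕ.≟ i ⌋) (allFin m))
        (lose (∈-allFin e) (any⁺ (λ e′ → ⌊ diffSize H e e′ ℕ.≟ i ⌋) (lose (∈-allFin e′) (fromWitness ds≡i))))

    1≤sizeI : ∀ {i} → i < k → inI H i ≡ true → 1 ≤ sizeI H
    1≤sizeI i<k i∈I = tally-≥1 (T? ∘ inI H) (∈-upTo⁺ i<k) (Equivalence.from T-≡ i∈I)

    module _ {Δ : ℕ} (deg≤Δ : ∀ v → deg H v ≤ Δ) where

      other-edges-through : ∀ e′ j → tally (λ e → ¬? (e ≟ e′) ×-dec T? (memB (edge e′ j) (edge e))) (allFin m) ≤ Δ ∸ 1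
      other-edges-through e′ j = m+n≤o⇒m≤o∸n _ (begin
        tally others? (allFin m) + 1                          ≤⟨ +-monoʳ-≤ _ (tally-≥1 (_≟ e′) (∈-allFin e′) refl) ⟩
        tally others? (allFin m) + tally (_≟ e′) (allFin m)   ≤⟨ tally-disjoint through? others? (_≟ e′) (allFin m)
                                                                   proj₂ (λ { refl → T-memB⁺ {P = edge e′} {j} refl }) proj₁ ⟩
        deg H (edge e′ j)                                     ≤⟨ deg≤Δ (edge e′ j) ⟩
        Δ                                                     ∎)
        where
        open ℕ.≤-Reasoning
        through? : ∀ e → Dec (T (memB (edge e′ j) (edge e)))
        through? e = T? (memB (edge e′ j) (edge e))
        others? : ∀ e → Dec (e ≢ e′ × T (memB (edge e′ j) (edge e)))
        others? e = ¬? (e ≟ e′) ×-dec through? e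

      -- (k - i) vertices of e′ lie in every edge e with |e′ ∖ e| = i, and each of the k vertices of e′ lies in at most Δ - 1 other edges.
      edges-at-distance : ∀ e′ i → (k ∸ i) * tally (λ e → ¬? (e ≟ e′) ×-dec (diffSize H e′ e ℕ.≟ i)) (allFin m) ≤ k * (Δ ∸ 1)
      edges-at-distance e′ i = begin
        (k ∸ i) * tally Near? (allFin m)                              ≡⟨ ℕ.*-comm (k ∸ i) _ ⟩
        tally Near? (allFin m) * (k ∸ i)                              ≡⟨ ∑-indicator-* Near? (k ∸ i) (allFin m) ⟨
        ∑[ e ← allFin m ] (if does (Near? e) then k ∸ i else 0)       ≤⟨ ∑-mono (allFin m) (λ {e} _ → if-does-≤ (Near? e) (shared e)) ⟩
        ∑[ e ← allFin m ] ∑[ j ← allFin k ] indicator (Shares? j) e   ≡⟨ ∑-swap (λ e j → indicator (Shares? j) e) (allFin m) (allFin k) ⟩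
        ∑[ j ← allFin k ] ∑ (indicator (Shares? j)) (allFin m)
          ≡⟨ ∑-cong (allFin k) (λ {j} _ → tally≡∑indicator (Shares? j) (allFin m)) ⟨
        ∑[ j ← allFin k ] tally (Shares? j) (allFin m)                ≤⟨ ∑-mono (allFin k) (λ {j} _ → other-edges-through e′ j) ⟩
        ∑[ j ← allFin k ] (Δ ∸ 1)                                     ≡⟨ ∑-const (Δ ∸ 1) (allFin k) ⟩
        length (allFin k) * (Δ ∸ 1)                                   ≡⟨ cong (_* (Δ ∸ 1)) (length-allFin k) ⟩
        k * (Δ ∸ 1)                                                   ∎
        where
        open ℕ.≤-Reasoning
        Near? : ∀ e → Dec (e ≢ e′ × diffSize H e′ e ≡ i)
        Near? e = ¬? (e ≟ e′) ×-dec (diffSize H e′ e ℕ.≟ i)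
        Shares? : ∀ j e → Dec (e ≢ e′ × T (memB (edge e′ j) (edge e)))
        Shares? j e = ¬? (e ≟ e′) ×-dec T? (memB (edge e′ j) (edge e))
        shared : ∀ e → e ≢ e′ × diffSize H e′ e ≡ i → k ∸ i ≤ ∑[ j ← allFin k ] indicator (Shares? j) e
        shared e (e≢e′ , refl) = begin
          k ∸ diffSize H e′ e                        ≤⟨ m≤n+o⇒m∸n≤o k (diffSize H e′ e) k≤ ⟩
          tally inside? (allFin k)                   ≤⟨ tally-mono inside? (λ j → Shares? j e) (allFin k) (λ _ t → e≢e′ , t) ⟩
          tally (λ j → Shares? j e) (allFin k)       ≡⟨ tally≡∑indicator (λ j → Shares? j e) (allFin k) ⟩
          ∑[ j ← allFin k ] indicator (Shares? j) e  ∎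
          where
          inside? : ∀ j → Dec (T (memB (edge e′ j) (edge e)))
          inside? j = T? (memB (edge e′ j) (edge e))
          always? : ∀ (j : Fin k) → Dec ⊤
          always? _ = yes tt
          k≤ : k ≤ diffSize H e′ e + tally inside? (allFin k)
          k≤ = begin
            k                                           ≡⟨ length-allFin k ⟨
            length (allFin k)                           ≡⟨ tally-universal always? (λ _ → tt) (allFin k) ⟨
            tally always? (allFin k)                    ≤⟨ tally-split always? (outside? e′ e) inside? (allFin k)
                                                             (λ {j} _ _ → Sum.swap (Sum.map₂ T-not⁺ (Dec.toSum (inside? j)))) ⟩
            diffSize H e′ e + tally inside? (allFin k)  ∎

module PartialColourings {n m k : ℕ} (H : SeqHypergraph n m k) (Π : PermSet k) (L : Fin n → List ℕ) where

  open import Data.Bool.Base using (true; false; if_then_else_; T)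
  open import Data.Bool.Properties using (T?)
  open import Data.Nat.Base using (suc; _+_; _*_; _∸_; _≤_; _<_)
  open import Data.Nat.Properties using (+-monoʳ-≤; *-monoʳ-≤; *-monoˡ-≤; ≤-reflexive)
  import Data.Nat.Properties as ℕ
  open import Data.Fin.Properties using (_≟_; any?; all?)
  open import Data.Fin.Permutation using (Permutation′; _⟨$⟩ʳ_; _⟨$⟩ˡ_; inverseʳ)
  open import Data.Fin.Subset using (Subset; ⊤; ⊥; _∪_; ⁅_⁆; _⊆_) renaming (_∈_ to _∈ˢ_; _∉_ to _∉ˢ_)
  open import Data.Fin.Subset.Properties using (∈⊤; ∉⊥; x∈p∪q⁺; x∈p∪q⁻; x∈⁅x⁆; x∈⁅y⁆⇒x≡y; p⊆p∪q) renaming (_∈?_ to _∈ˢ?_)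
  open import Data.Vec.Base using (Vec; lookup; replicate; tabulate; _[_]≔_)
  open import Data.Vec.Properties using (lookup-replicate; lookup∘tabulate; lookup∘update′)
  open import Data.List.Base using ([]; _∷_; [_]; length; filter; upTo; allFin; concatMap; cartesianProduct; cartesianProductWith)
  open import Data.List.Membership.Propositional using (_∈_; _∉_; find; lose)
  open import Data.List.Membership.DecPropositional (_≟_ {n}) using () renaming (_∈?_ to _∈ˡ?_)
  open import Data.List.Relation.Unary.Unique.Propositional using (Unique)
  import Data.List.Relation.Unary.All as All
  import Data.List.Relation.Unary.AllPairs as AllPairs
  open import Data.List.Membership.Propositional.Properties
    using (∈-allFin; ∈-filter⁺; ∈-filter⁻; ∈-upTo⁺; ∈-upTo⁻; ∈-concatMap⁺; ∈-concatMap⁻; ∈-cartesianProduct⁺; ∈-cartesianProductWith⁺)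
  open import Data.List.Relation.Unary.Any as Any using (Any; here)
  open import Data.Product.Base using (∃; _×_; _,_; proj₁; proj₂)
  open import Data.Sum.Base using (_⊎_; inj₁; inj₂)
  open import Function.Base using (_∘_)
  open import Relation.Nullary using (¬_; Dec; yes; no; does; contradiction; ¬?; _×-dec_; _→-dec_)
  open import Relation.Nullary.Decidable using (dec-true; dec-false)
  open import Relation.Unary using (Decidable)
  open import Relation.Binary.PropositionalEquality using (_≡_; _≢_; refl; sym; trans; cong; subst; subst₂; module ≡-Reasoning)
  open import Defs using (Distinguishing; diffSize; deg; memB; inI)
  open Counting
  open Assignments
  open Hypergraph
  open Subsets

  open SeqHypergraph H
  open PermSet Π

  Perm : Set
  Perm = Permutation′ k

  Colouring : Set
  Colouring = Vec ℕ n

  -- Position j of the pair (e, e′) under σ constrains a colouring only if it compares two different vertices.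
  Relevant : Fin m → Fin m → Perm → Fin k → Set
  Relevant e e′ σ j = edge e (σ ⟨$⟩ʳ j) ≢ edge e′ j

  Within : Subset n → Fin m → Fin m → Perm → Set
  Within S e e′ σ = ∀ j → Relevant e e′ σ j → edge e (σ ⟨$⟩ʳ j) ∈ˢ S × edge e′ j ∈ˢ S

  Matches : Colouring → Fin m → Fin m → Perm → Set
  Matches ψ e e′ σ = ∀ j → Relevant e e′ σ j → lookup ψ (edge e (σ ⟨$⟩ʳ j)) ≡ lookup ψ (edge e′ j)

  Conflict : Subset n → Colouring → Fin m → Fin m → Perm → Set
  Conflict S ψ e e′ σ = e ≢ e′ × Intersecting H e e′ × Within S e e′ σ × Matches ψ e e′ σ

  Conflicted : Subset n → Colouring → Set
  Conflicted S ψ = ∃ λ e → ∃ λ e′ → Any (Conflict S ψ e e′) perms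

  Proper : Subset n → Colouring → Set
  Proper S ψ = ¬ Conflicted S ψ

  relevant? : ∀ e e′ σ j → Dec (Relevant e e′ σ j)
  relevant? e e′ σ j = ¬? (edge e (σ ⟨$⟩ʳ j) ≟ edge e′ j)

  conflicted? : ∀ S → Decidable (Conflicted S)
  conflicted? S ψ = any? λ e → any? λ e′ → Any.any? (conflict? e e′) perms
    where
    conflict? : ∀ e e′ σ → Dec (Conflict S ψ e e′ σ)
    conflict? e e′ σ = ¬? (e ≟ e′)
      ×-dec any? (λ j → any? λ j′ → edge e j ≟ edge e′ j′)
      ×-dec all? (λ j → relevant? e e′ σ j →-dec ((edge e (σ ⟨$⟩ʳ j) ∈ˢ? S) ×-dec (edge e′ j ∈ˢ? S)))
      ×-dec all? (λ j → relevant? e e′ σ j →-dec (lookup ψ (edge e (σ ⟨$⟩ʳ j)) ℕ.≟ lookup ψ (edge e′ j)))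

  proper? : ∀ S → Decidable (Proper S)
  proper? S = ¬? ∘ conflicted? S

  proper-local : ∀ {S B φ φ′} → Proper S φ → (∀ {x} → x ∈ˢ B → x ∈ˢ S × lookup φ x ≡ lookup φ′ x) → Proper B φ′
  proper-local {S} {B} {φ} {φ′} proper agree (e , e′ , conflict) = proper (e , e′ , Any.map (λ {σ} → widen {σ}) conflict)
    where
    widen : ∀ {σ} → Conflict B φ′ e e′ σ → Conflict S φ e e′ σ
    widen (e≢e′ , meet , within , matches) =
        e≢e′ , meet
      , (λ j r → let (a , b) = within j r in proj₁ (agree a) , proj₁ (agree b))
      , (λ j r → let (a , b) = within j r in trans (proj₂ (agree a)) (trans (matches j r) (sym (proj₂ (agree b)))))

  proper-⊤⇒distinguishing : ∀ ψ → Proper ⊤ ψ → Distinguishing H Π (lookup ψ)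
  proper-⊤⇒distinguishing ψ proper e e′ e≢e′ meet (σ , σ∈ , same) =
    proper (e , e′ , lose σ∈ (e≢e′ , meet , (λ _ _ → ∈⊤ , ∈⊤) , (λ j _ → same j)))

  -- With nothing coloured a conflict would make σ map e onto e′, so e and e′ would be the same edge.
  proper-⊥ : ∀ ψ → Proper ⊥ ψ
  proper-⊥ ψ (e , e′ , conflict) with σ , _ , (e≢e′ , _ , within , _) ← find conflict =
    simple e e′ e≢e′ (e⊆e′ , λ j′ → σ ⟨$⟩ʳ j′ , sym (fixed j′))
    where
    fixed : ∀ j → edge e (σ ⟨$⟩ʳ j) ≡ edge e′ j
    fixed j with edge e (σ ⟨$⟩ʳ j) ≟ edge e′ j
    ... | yes same = same
    ... | no r     = contradiction (proj₂ (within j r)) ∉⊥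
    e⊆e′ : ∀ j → ∃ λ j′ → edge e j ≡ edge e′ j′
    e⊆e′ j = σ ⟨$⟩ˡ j , trans (cong (edge e) (sym (inverseʳ σ))) (fixed (σ ⟨$⟩ˡ j))

  module _ {e e′ : Fin m} {σ τ : Perm} (τσ : ∀ j → τ ⟨$⟩ʳ (σ ⟨$⟩ʳ j) ≡ j) where

    private
      στ : ∀ j → σ ⟨$⟩ʳ (τ ⟨$⟩ʳ j) ≡ j
      στ j = begin
        σ ⟨$⟩ʳ (τ ⟨$⟩ʳ j)                          ≡⟨ cong (λ x → σ ⟨$⟩ʳ (τ ⟨$⟩ʳ x)) (inverseʳ σ) ⟨
        σ ⟨$⟩ʳ (τ ⟨$⟩ʳ (σ ⟨$⟩ʳ (σ ⟨$⟩ˡ j)))        ≡⟨ cong (σ ⟨$⟩ʳ_) (τσ (σ ⟨$⟩ˡ j)) ⟩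
        σ ⟨$⟩ʳ (σ ⟨$⟩ˡ j)                          ≡⟨ inverseʳ σ ⟩
        j                                          ∎
        where open ≡-Reasoning

    relevant-reverse : ∀ {j} → Relevant e′ e τ j → Relevant e e′ σ (τ ⟨$⟩ʳ j)
    relevant-reverse {j} r eq = r (sym (trans (cong (edge e) (sym (στ j))) eq))

    relevant-reverse′ : ∀ {j} → Relevant e e′ σ j → Relevant e′ e τ (σ ⟨$⟩ʳ j)
    relevant-reverse′ {j} r eq = r (sym (trans (cong (edge e′) (sym (τσ j))) eq))

    within-reverse : ∀ {S} → Within S e e′ σ → Within S e′ e τ
    within-reverse {S} within j r with within (τ ⟨$⟩ʳ j) (relevant-reverse r)
    ... | a , b = b , subst (λ x → edge e x ∈ˢ S) (στ j) a

    matches-reverse : ∀ {ψ} → Matches ψ e e′ σ → Matches ψ e′ e τ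
    matches-reverse {ψ} matches j r =
      sym (trans (cong (lookup ψ ∘ edge e) (sym (στ j))) (matches (τ ⟨$⟩ʳ j) (relevant-reverse r)))

  -- Vertices outside S carry the dummy colour 0, which no conflict within S can see.
  palette : Subset n → Fin n → List ℕ
  palette S x = if does (x ∈ˢ? S) then L x else [ 0 ]

  palette-∈ : ∀ {S x} → x ∈ˢ S → palette S x ≡ L x
  palette-∈ {S} {x} x∈S = cong (λ b → if b then L x else [ 0 ]) (dec-true (x ∈ˢ? S) x∈S)

  palette-∉ : ∀ {S x} → x ∉ˢ S → palette S x ≡ [ 0 ]
  palette-∉ {S} {x} x∉S = cong (λ b → if b then L x else [ 0 ]) (dec-false (x ∈ˢ? S) x∉S)

  colourings : Subset n → List Colouring
  colourings S = assignments (palette S)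

  properCount : Subset n → ℕ
  properCount S = tally (proper? S) (colourings S)

  1≤properCount-⊥ : 1 ≤ properCount ⊥
  1≤properCount-⊥ = tally-≥1 (proper? ⊥) (∈-assignments⁺ (palette ⊥) {replicate n 0} zeros∈) (proper-⊥ (replicate n 0))
    where
    zeros∈ : ∀ x → lookup (replicate n 0) x ∈ palette ⊥ x
    zeros∈ x rewrite lookup-replicate x 0 | palette-∉ {⊥} {x} ∉⊥ = here refl

  properCount-⊤-witness : 1 ≤ properCount ⊤ → ∃ λ ψ → (∀ x → lookup ψ x ∈ L x) × Proper ⊤ ψ
  properCount-⊤-witness pos with ψ , ψ∈ , proper ← tally-witness (proper? ⊤) _ pos =
    ψ , (λ x → subst (lookup ψ x ∈_) (palette-∈ ∈⊤) (∈-assignments⁻ (palette ⊤) ψ∈ x)) , proper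

  restrict : Subset n → Colouring → Colouring
  restrict B ψ = tabulate λ x → if does (x ∈ˢ? B) then lookup ψ x else 0

  lookup-restrict-∈ : ∀ {B ψ x} → x ∈ˢ B → lookup (restrict B ψ) x ≡ lookup ψ x
  lookup-restrict-∈ {B} {ψ} {x} x∈B =
    trans (lookup∘tabulate _ x) (cong (λ b → if b then lookup ψ x else 0) (dec-true (x ∈ˢ? B) x∈B))

  lookup-restrict-∉ : ∀ {B ψ x} → x ∉ˢ B → lookup (restrict B ψ) x ≡ 0
  lookup-restrict-∉ {B} {ψ} {x} x∉B =
    trans (lookup∘tabulate _ x) (cong (λ b → if b then lookup ψ x else 0) (dec-false (x ∈ˢ? B) x∉B))

  Triple : Set
  Triple = Fin m × Fin m × Perm

  triples : List Triple
  triples = cartesianProductWith (λ e′ (e , σ) → e , e′ , σ) (allFin m) (cartesianProduct (allFin m) perms)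

  ∈-triples : ∀ {e e′ σ} → σ ∈ perms → (e , e′ , σ) ∈ triples
  ∈-triples {e} {e′} σ∈ = ∈-cartesianProductWith⁺ (λ e′ (e , σ) → e , e′ , σ) (∈-allFin e′) (∈-cartesianProduct⁺ (∈-allFin e) σ∈)

  indices : List ℕ
  indices = filter (λ i → 1 ℕ.≤? i) (upTo k)

  ∈-indices⁺ : ∀ {i} → 1 ≤ i → i < k → i ∈ indices
  ∈-indices⁺ 1≤i i<k = ∈-filter⁺ (λ i → 1 ℕ.≤? i) (∈-upTo⁺ i<k) 1≤i

  ∈-indices⁻ : ∀ {i} → i ∈ indices → 1 ≤ i × i < k
  ∈-indices⁻ i∈ with i∈upTo , 1≤i ← ∈-filter⁻ (λ i → 1 ℕ.≤? i) {xs = upTo k} i∈ = 1≤i , ∈-upTo⁻ i∈upTo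

  module Step (S : Subset n) (v : Fin n) (v∉S : v ∉ˢ S) where

    S⁺ : Subset n
    S⁺ = S ∪ ⁅ v ⁆

    v∈S⁺ : v ∈ˢ S⁺
    v∈S⁺ = x∈p∪q⁺ (inj₂ (x∈⁅x⁆ v))

    S⊆S⁺ : S ⊆ S⁺
    S⊆S⁺ = p⊆p∪q ⁅ v ⁆

    ∈S⁺⇒∈S : ∀ {x} → x ≢ v → x ∈ˢ S⁺ → x ∈ˢ S
    ∈S⁺⇒∈S x≢v x∈S⁺ with x∈p∪q⁻ S ⁅ v ⁆ x∈S⁺
    ... | inj₁ x∈S = x∈S
    ... | inj₂ x∈v = contradiction (x∈⁅y⁆⇒x≡y v x∈v) x≢v

    palette-S⁺ : ∀ x → x ≢ v → palette S x ≡ palette S⁺ x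
    palette-S⁺ x x≢v with x ∈ˢ? S
    ... | yes x∈S = sym (palette-∈ (S⊆S⁺ x∈S))
    ... | no x∉S  = sym (palette-∉ (x∉S ∘ ∈S⁺⇒∈S x≢v))

    -- A pivot is a potential conflict on S⁺ in which v occurs, oriented so that v is on the e′ side.
    Pivot : ℕ → Triple → Set
    Pivot i (e , e′ , σ) = e ≢ e′ × Within S⁺ e e′ σ × diffSize H e′ e ≡ i × ∃ λ j → edge e′ j ≡ v × Relevant e e′ σ j

    pivot? : ∀ i → Decidable (Pivot i)
    pivot? i (e , e′ , σ) = ¬? (e ≟ e′)
      ×-dec all? (λ j → relevant? e e′ σ j →-dec ((edge e (σ ⟨$⟩ʳ j) ∈ˢ? S⁺) ×-dec (edge e′ j ∈ˢ? S⁺)))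
      ×-dec diffSize H e′ e ℕ.≟ i
      ×-dec any? (λ j → (edge e′ j ≟ v) ×-dec relevant? e e′ σ j)

    pivots : ℕ → List Triple
    pivots i = filter (pivot? i) triples

    allPivots : List Triple
    allPivots = concatMap pivots indices

    ∈-allPivots : ∀ {e e′ σ} → σ ∈ perms → Intersecting H e e′ → Pivot (diffSize H e′ e) (e , e′ , σ) → (e , e′ , σ) ∈ allPivots
    ∈-allPivots σ∈ (j , j′ , meet) pivot@(e≢e′ , _) = ∈-concatMap⁺ pivots (lose
      (∈-indices⁺ (diffSize-pos H e≢e′) (diffSize-< H meet))
      (∈-filter⁺ (pivot? _) (∈-triples σ∈) pivot))

    ∈-allPivots⁻ : ∀ {t} → t ∈ allPivots → ∃ λ i → i ∈ indices × Pivot i t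
    ∈-allPivots⁻ {t} t∈ with i , i∈ , t∈pivots ← find (∈-concatMap⁻ pivots {xs = indices} t∈) =
      i , i∈ , proj₂ (∈-filter⁻ (pivot? i) {xs = triples} t∈pivots)

    Spoiled : Colouring → Set
    Spoiled ψ = Proper S (ψ [ v ]≔ 0) × Conflicted S⁺ ψ

    SpoiledAt : Triple → Colouring → Set
    SpoiledAt (e , e′ , σ) ψ = Proper S (ψ [ v ]≔ 0) × Matches ψ e e′ σ

    spoiled? : Decidable Spoiled
    spoiled? ψ = proper? S (ψ [ v ]≔ 0) ×-dec conflicted? S⁺ ψ

    spoiledAt? : ∀ t → Decidable (SpoiledAt t)
    spoiledAt? (e , e′ , σ) ψ = proper? S (ψ [ v ]≔ 0)
      ×-dec all? (λ j → relevant? e e′ σ j →-dec (lookup ψ (edge e (σ ⟨$⟩ʳ j)) ℕ.≟ lookup ψ (edge e′ j)))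

    -- A conflict on S⁺ that is no conflict on S once v is reset has v at a relevant position;
    -- if v is on the e side, σ⁻¹ ∈ Π reverses it into a pivot.
    spoiled⇒pivot : ∀ {ψ} → Spoiled ψ → ∃ λ t → t ∈ allPivots × SpoiledAt t ψ
    spoiled⇒pivot {ψ} (proper , e , e′ , conflict)
      with σ , σ∈ , (e≢e′ , meet , within , matches) ← find conflict
      with any? (λ j → (edge e′ j ≟ v) ×-dec relevant? e e′ σ j) | any? (λ j → (edge e (σ ⟨$⟩ʳ j) ≟ v) ×-dec relevant? e e′ σ j)
    ... | yes (j , e′j≡v , r) | _ =
      (e , e′ , σ) , ∈-allPivots σ∈ meet (e≢e′ , within , refl , j , e′j≡v , r) , proper , matches
    ... | no ¬right | no ¬left =
      contradiction (e , e′ , lose σ∈ (e≢e′ , meet , withinS , matches-reset)) proper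
      where
      withinS : Within S e e′ σ
      withinS j r with within j r
      ... | a , b = ∈S⁺⇒∈S (λ eq → ¬left (j , eq , r)) a , ∈S⁺⇒∈S (λ eq → ¬right (j , eq , r)) b
      matches-reset : Matches (ψ [ v ]≔ 0) e e′ σ
      matches-reset j r = trans (lookup∘update′ (λ eq → ¬left (j , eq , r)) ψ 0)
                                (trans (matches j r) (sym (lookup∘update′ (λ eq → ¬right (j , eq , r)) ψ 0)))
    ... | no _ | yes (j , ej≡v , r) with τ , τ∈ , τσ ← invClosed σ σ∈ =
      (e′ , e , τ)
      , ∈-allPivots τ∈ (intersecting-sym H meet)
          (e≢e′ ∘ sym , within-reverse {e} {e′} {σ} {τ} τσ within , refl , σ ⟨$⟩ʳ j , ej≡v , relevant-reverse′ {e} {e′} {σ} {τ} τσ r)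
      , proper , matches-reverse {e} {e′} {σ} {τ} τσ {ψ} matches

    extension-count : length (L v) * properCount S ≤ properCount S⁺ + ∑[ t ← allPivots ] tally (spoiledAt? t) (colourings S⁺)
    extension-count = begin
      length (L v) * properCount S
        ≡⟨ cong (λ ls → length ls * properCount S) (palette-∈ v∈S⁺) ⟨
      length (palette S⁺ v) * properCount S
        ≡⟨ tally-free-coordinate (proper? S) v 0 (palette S) (palette S⁺) (palette-∉ v∉S) palette-S⁺ ⟨
      tally (proper? S ∘ (_[ v ]≔ 0)) (colourings S⁺)
        ≤⟨ tally-split (proper? S ∘ (_[ v ]≔ 0)) (proper? S⁺) spoiled? (colourings S⁺) split ⟩
      properCount S⁺ + tally spoiled? (colourings S⁺)
        ≤⟨ +-monoʳ-≤ (properCount S⁺) (tally-union spoiled? spoiledAt? allPivots (colourings S⁺) (λ {ψ} _ → spoiled⇒pivot {ψ})) ⟩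
      properCount S⁺ + ∑[ t ← allPivots ] tally (spoiledAt? t) (colourings S⁺) ∎
      where
      open ℕ.≤-Reasoning
      split : ∀ {ψ} → ψ ∈ colourings S⁺ → Proper S (ψ [ v ]≔ 0) → Proper S⁺ ψ ⊎ Spoiled ψ
      split {ψ} _ proper with conflicted? S⁺ ψ
      ... | yes conflicted = inj₂ (proper , conflicted)
      ... | no ¬conflicted = inj₁ ¬conflicted

    -- i - 1 vertices of e′ ∖ e avoiding v; in a colouring matching the pivot they copy colours of vertices of e.
    released : Triple → List (Fin n)
    released (e , e′ , σ) = removeOrDrop _≟_ v (difference H e′ e)

    base : Triple → Subset n
    base t = removeAll S (released t)

    module Encoding {i e e′ σ} (pivot : Pivot i (e , e′ , σ)) where

      private
        t : Triple
        t = e , e′ , σ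
        W : List (Fin n)
        W = released t
        B : Subset n
        B = base t

      e≢e′ : e ≢ e′
      e≢e′ = proj₁ pivot

      released-unique : Unique W
      released-unique = removeOrDrop-unique _≟_ v (difference-unique H e′ e)

      length-released : suc (length W) ≡ i
      length-released = trans
        (length-removeOrDrop _≟_ v {difference H e′ e} (subst (1 ≤_) (sym (length-difference H e′ e)) (diffSize-pos H e≢e′)))
        (trans (length-difference H e′ e) (proj₁ (proj₂ (proj₂ pivot))))

      v∉released : v ∉ W
      v∉released = v∉removeOrDrop _≟_ v (difference-unique H e′ e)

      released-outside : ∀ {x} → x ∈ W → (∃ λ j → x ≡ edge e′ j) × (∀ j → x ≢ edge e j)
      released-outside x∈W = ∈-difference⁻ H (removeOrDrop-⊆ _≟_ v (difference H e′ e) x∈W)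

      released-relevant : ∀ {j} → edge e′ j ∈ W → Relevant e e′ σ j
      released-relevant {j} x∈W eq = proj₂ (released-outside x∈W) (σ ⟨$⟩ʳ j) (sym eq)

      released⊆S : ∀ {x} → x ∈ W → x ∈ˢ S
      released⊆S {x} x∈W with (j , refl) , _ ← released-outside x∈W =
        ∈S⁺⇒∈S (λ x≡v → v∉released (subst (_∈ W) x≡v x∈W)) (proj₂ (proj₁ (proj₂ pivot) j (released-relevant x∈W)))

      base⊆S : ∀ {x} → x ∈ˢ B → x ∈ˢ S
      base⊆S x∈B = proj₁ (∈-removeAll⁻ S W x∈B)

      base-avoids-v : ∀ {x} → x ∈ˢ B → x ≢ v
      base-avoids-v x∈B refl = v∉S (base⊆S x∈B)

      insertAll-base : insertAll B W ≡ S
      insertAll-base = insertAll-removeAll S W released⊆S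

      -- Colours on W are recovered from the matching vertices of e (none in W), and the colour of v likewise.
      restrict-injective : ∀ {ψ₁ ψ₂} → ψ₁ ∈ colourings S⁺ → ψ₂ ∈ colourings S⁺ →
        Matches ψ₁ e e′ σ → Matches ψ₂ e e′ σ → restrict B ψ₁ ≡ restrict B ψ₂ → ψ₁ ≡ ψ₂
      restrict-injective {ψ₁} {ψ₂} ψ₁∈ ψ₂∈ matches₁ matches₂ same = lookup-extensional agree
        where
        uncoloured : ∀ {ψ x} → ψ ∈ colourings S⁺ → x ∉ˢ S⁺ → lookup ψ x ≡ 0
        uncoloured {ψ} {x} ψ∈ x∉S⁺ with subst (lookup ψ x ∈_) (palette-∉ x∉S⁺) (∈-assignments⁻ (palette S⁺) ψ∈ x)
        ... | here ψx≡0 = ψx≡0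
        agree-off : ∀ x → x ≢ v → x ∉ W → lookup ψ₁ x ≡ lookup ψ₂ x
        agree-off x x≢v x∉W with x ∈ˢ? B
        ... | yes x∈B = trans (sym (lookup-restrict-∈ {B} {ψ₁} x∈B)) (trans (cong (λ ψ → lookup ψ x) same) (lookup-restrict-∈ {B} {ψ₂} x∈B))
        ... | no x∉B  = trans (uncoloured ψ₁∈ x∉S⁺) (sym (uncoloured ψ₂∈ x∉S⁺))
          where
          x∉S⁺ : x ∉ˢ S⁺
          x∉S⁺ x∈S⁺ = x∉B (∈-removeAll⁺ S W (∈S⁺⇒∈S x≢v x∈S⁺) x∉W)
        partner : ∀ j → Relevant e e′ σ j → edge e (σ ⟨$⟩ʳ j) ∉ W
        partner j _ u∈W = proj₂ (released-outside u∈W) (σ ⟨$⟩ʳ j) refl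
        agree-v : lookup ψ₁ v ≡ lookup ψ₂ v
        agree-v with j , refl , r ← proj₂ (proj₂ (proj₂ pivot)) = begin
          lookup ψ₁ (edge e′ j)          ≡⟨ matches₁ j r ⟨
          lookup ψ₁ (edge e (σ ⟨$⟩ʳ j))  ≡⟨ agree-off _ r (partner j r) ⟩
          lookup ψ₂ (edge e (σ ⟨$⟩ʳ j))  ≡⟨ matches₂ j r ⟩
          lookup ψ₂ (edge e′ j)          ∎
          where open ≡-Reasoning
        agree-W : ∀ x → x ∈ W → lookup ψ₁ x ≡ lookup ψ₂ x
        agree-W x x∈W with (j , refl) , _ ← released-outside x∈W = begin
          lookup ψ₁ (edge e′ j)          ≡⟨ matches₁ j r ⟨
          lookup ψ₁ (edge e (σ ⟨$⟩ʳ j))  ≡⟨ agree-partner ⟩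
          lookup ψ₂ (edge e (σ ⟨$⟩ʳ j))  ≡⟨ matches₂ j r ⟩
          lookup ψ₂ (edge e′ j)          ∎
          where
          open ≡-Reasoning
          r = released-relevant x∈W
          agree-partner : lookup ψ₁ (edge e (σ ⟨$⟩ʳ j)) ≡ lookup ψ₂ (edge e (σ ⟨$⟩ʳ j))
          agree-partner with edge e (σ ⟨$⟩ʳ j) ≟ v
          ... | yes u≡v = subst (λ u → lookup ψ₁ u ≡ lookup ψ₂ u) (sym u≡v) agree-v
          ... | no u≢v  = agree-off _ u≢v (partner j r)
        agree : ∀ x → lookup ψ₁ x ≡ lookup ψ₂ x
        agree x with x ≟ v | x ∈ˡ? W
        ... | yes refl | _        = agree-v
        ... | no x≢v   | yes x∈W  = agree-W x x∈W
        ... | no x≢v   | no x∉W   = agree-off x x≢v x∉W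

      restrict-proper : ∀ {ψ} → ψ ∈ colourings S⁺ → SpoiledAt t ψ → restrict B ψ ∈ colourings B × Proper B (restrict B ψ)
      restrict-proper {ψ} ψ∈ (proper , _) =
        ∈-assignments⁺ (palette B) allowed , proper-local {S} {B} {ψ [ v ]≔ 0} {restrict B ψ} proper agree
        where
        allowed : ∀ x → lookup (restrict B ψ) x ∈ palette B x
        allowed x with x ∈ˢ? B
        ... | yes x∈B = subst₂ _∈_ (sym (lookup-restrict-∈ {B} {ψ} x∈B)) (palette-∈ (S⊆S⁺ (base⊆S x∈B)))
                          (∈-assignments⁻ (palette S⁺) ψ∈ x)
        ... | no x∉B  = subst (_∈ [ 0 ]) (sym (lookup-restrict-∉ {B} {ψ} x∉B)) (here refl)
        agree : ∀ {x} → x ∈ˢ B → x ∈ˢ S × lookup (ψ [ v ]≔ 0) x ≡ lookup (restrict B ψ) x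
        agree x∈B = base⊆S x∈B , trans (lookup∘update′ (base-avoids-v x∈B) ψ 0) (sym (lookup-restrict-∈ {B} {ψ} x∈B))

      spoiledAt-count : (∀ x → Unique (L x)) → tally (spoiledAt? t) (colourings S⁺) ≤ properCount B
      spoiledAt-count L-unique = tally-injection (spoiledAt? t) (proper? B) (restrict B) (colourings B)
        (assignments-unique (palette S⁺) palette-unique) restrict-proper
        (λ ψ₁∈ ψ₂∈ (_ , matches₁) (_ , matches₂) → restrict-injective ψ₁∈ ψ₂∈ matches₁ matches₂)
        where
        palette-unique : ∀ x → Unique (palette S⁺ x)
        palette-unique x with does (x ∈ˢ? S⁺)
        ... | true  = L-unique x
        ... | false = All.[] AllPairs.∷ AllPairs.[]

    module _ {Δ : ℕ} (deg≤Δ : ∀ x → deg H x ≤ Δ) where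

      -- Every pivot lies on an edge e′ through v and an edge e at distance i from it.
      pivots-count : ∀ i → (k ∸ i) * length (pivots i) ≤ Δ * (k * (Δ ∸ 1) * length perms)
      pivots-count i = begin
        (k ∸ i) * length (pivots i)
          ≤⟨ *-monoʳ-≤ (k ∸ i) (tally-mono (pivot? i) near? triples (λ { {e , e′ , σ} _ → pivot⇒near {e} {e′} {σ} })) ⟩
        (k ∸ i) * tally near? triples
          ≡⟨ cong ((k ∸ i) *_) (tally-cartesianProductWith near? (λ e′ (e , σ) → e , e′ , σ) (allFin m) _) ⟩
        (k ∸ i) * ∑[ e′ ← allFin m ] tally (λ (e , σ) → near? (e , e′ , σ)) (cartesianProduct (allFin m) perms)
          ≡⟨ cong ((k ∸ i) *_) (∑-cong (allFin m) (λ {e′} _ → factor e′)) ⟩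
        (k ∸ i) * ∑[ e′ ← allFin m ] ((if memB v (edge e′) then tally (distance? e′) (allFin m) else 0) * π)
          ≡⟨ ∑-*ˡ (k ∸ i) _ (allFin m) ⟨
        ∑[ e′ ← allFin m ] ((k ∸ i) * ((if memB v (edge e′) then tally (distance? e′) (allFin m) else 0) * π))
          ≤⟨ ∑-mono (allFin m) (λ {e′} _ → per-edge e′) ⟩
        ∑[ e′ ← allFin m ] (if memB v (edge e′) then k * (Δ ∸ 1) * π else 0)
          ≡⟨ ∑-indicator-* (λ e′ → T? (memB v (edge e′))) (k * (Δ ∸ 1) * π) (allFin m) ⟩
        deg H v * (k * (Δ ∸ 1) * π)
          ≤⟨ *-monoˡ-≤ _ (deg≤Δ v) ⟩
        Δ * (k * (Δ ∸ 1) * π) ∎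
        where
        open ℕ.≤-Reasoning
        π : ℕ
        π = length perms
        distance? : ∀ e′ e → Dec (e ≢ e′ × diffSize H e′ e ≡ i)
        distance? e′ e = ¬? (e ≟ e′) ×-dec (diffSize H e′ e ℕ.≟ i)
        near? : Decidable λ ((e , e′ , σ) : Triple) → T (memB v (edge e′)) × e ≢ e′ × diffSize H e′ e ≡ i
        near? (e , e′ , σ) = T? (memB v (edge e′)) ×-dec distance? e′ e
        pivot⇒near : ∀ {e e′ σ} → Pivot i (e , e′ , σ) → T (memB v (edge e′)) × e ≢ e′ × diffSize H e′ e ≡ i
        pivot⇒near {e′ = e′} (e≢e′ , _ , ds≡i , j , e′j≡v , _) = T-memB⁺ {P = edge e′} (sym e′j≡v) , e≢e′ , ds≡i
        factor : ∀ e′ → tally (λ (e , σ) → near? (e , e′ , σ)) (cartesianProduct (allFin m) perms)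
                      ≡ (if memB v (edge e′) then tally (distance? e′) (allFin m) else 0) * π
        factor e′ = begin-equality
          tally (λ (e , σ) → near? (e , e′ , σ)) (cartesianProduct (allFin m) perms)
            ≡⟨ tally-cartesianProductWith (λ (e , σ) → near? (e , e′ , σ)) _,_ (allFin m) perms ⟩
          ∑[ e ← allFin m ] tally (λ _ → T? (memB v (edge e′)) ×-dec distance? e′ e) perms
            ≡⟨ ∑-cong (allFin m) (λ {e} _ → tally-const (T? (memB v (edge e′)) ×-dec distance? e′ e) perms) ⟩
          ∑[ e ← allFin m ] (if does (T? (memB v (edge e′)) ×-dec distance? e′ e) then π else 0)
            ≡⟨ ∑-indicator-* (λ e → T? (memB v (edge e′)) ×-dec distance? e′ e) π (allFin m) ⟩
          tally (λ e → T? (memB v (edge e′)) ×-dec distance? e′ e) (allFin m) * π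
            ≡⟨ cong (_* π) (tally-×-dec-const (T? (memB v (edge e′))) (distance? e′) (allFin m)) ⟩
          (if memB v (edge e′) then tally (distance? e′) (allFin m) else 0) * π ∎
        per-edge : ∀ e′ → (k ∸ i) * ((if memB v (edge e′) then tally (distance? e′) (allFin m) else 0) * π)
                          ≤ (if memB v (edge e′) then k * (Δ ∸ 1) * π else 0)
        per-edge e′ with memB v (edge e′)
        ... | true  = begin
          (k ∸ i) * (tally (distance? e′) (allFin m) * π) ≡⟨ ℕ.*-assoc (k ∸ i) _ π ⟨
          (k ∸ i) * tally (distance? e′) (allFin m) * π   ≤⟨ *-monoˡ-≤ π (edges-at-distance H deg≤Δ e′ i) ⟩
          k * (Δ ∸ 1) * π                                  ∎
        ... | false = ≤-reflexive (ℕ.*-zeroʳ (k ∸ i))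

    pivots-inI : ∀ {i t} → i ∈ indices → t ∈ pivots i → inI H i ≡ true
    pivots-inI {i} {e , e′ , σ} i∈ t∈ with 1≤i , i<k ← ∈-indices⁻ i∈ =
      inI-intro H 1≤i i<k (proj₁ (proj₂ (proj₂ (proj₂ (∈-filter⁻ (pivot? i) {xs = triples} t∈)))))

module Rationals where

  open import Level using (Level)
  open import Data.Nat.Base as ℕ using (ℕ; zero; suc)
  import Data.Nat.Properties as ℕ
  open import Data.Integer.Base as ℤ using (+_)
  import Data.Integer.Properties as ℤ
  open import Data.Rational.Base using (ℚ; mkℚ; 0ℚ; 1ℚ; _/_; _+_; _*_; _-_; _≤_; _<_; *≤*; *<*; nonNegative; positive)
  open import Data.Rational.Properties
  import Data.Rational.Unnormalised.Base as ℚᵘ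
  import Data.Rational.Unnormalised.Properties as ℚᵘ
  import Data.Nat.Coprimality as Coprimality
  open import Data.Rational.Solver using (module +-*-Solver)
  open +-*-Solver
  open import Data.List.Base using (List; []; _∷_; length; foldr)
  open import Data.List.Membership.Propositional using (_∈_)
  open import Data.List.Relation.Unary.Any using (here; there)
  open import Data.Product.Base using (_,_)
  open import Function.Base using (_∘_)
  open import Relation.Nullary using (contradiction)
  open import Relation.Binary.PropositionalEquality using (_≡_; refl; sym; trans; cong; cong₂)
  open import Defs using (fromℕ; _//_; _^ℚ_)
  open Counting using (∑)

  private variable
    a : Level
    A : Set a

  private
    fromℕ≡mkℚ : ∀ m → fromℕ m ≡ mkℚ (+ m) 0 (Coprimality.sym (Coprimality.1-coprimeTo m))
    fromℕ≡mkℚ m = normalize-coprime (Coprimality.sym (Coprimality.1-coprimeTo m))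

  fromℕ-suc : ∀ m → fromℕ (suc m) ≡ 1ℚ + fromℕ m
  fromℕ-suc m rewrite fromℕ≡mkℚ m =
    cong (_/ 1) (sym (cong (ℤ._+_ (+ 1)) (ℤ.*-identityʳ (+ m))))

  fromℕ-+ : ∀ m n → fromℕ (m ℕ.+ n) ≡ fromℕ m + fromℕ n
  fromℕ-+ zero    n = sym (+-identityˡ (fromℕ n))
  fromℕ-+ (suc m) n rewrite fromℕ-suc (m ℕ.+ n) | fromℕ-+ m n | fromℕ-suc m = sym (+-assoc 1ℚ (fromℕ m) (fromℕ n))

  fromℕ-* : ∀ m n → fromℕ (m ℕ.* n) ≡ fromℕ m * fromℕ n
  fromℕ-* zero    n = sym (*-zeroˡ (fromℕ n))
  fromℕ-* (suc m) n rewrite fromℕ-+ n (m ℕ.* n) | fromℕ-* m n | fromℕ-suc m =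
    solve 2 (λ x y → y :+ x :* y := (con 1ℚ :+ x) :* y) refl (fromℕ m) (fromℕ n)

  fromℕ-nonneg : ∀ m → 0ℚ ≤ fromℕ m
  fromℕ-nonneg m = nonNegative⁻¹ (fromℕ m) {{normalize-nonNeg m 1}}

  fromℕ-pos : ∀ m → 0ℚ < fromℕ (suc m)
  fromℕ-pos m = positive⁻¹ (fromℕ (suc m)) {{normalize-pos (suc m) 1}}

  fromℕ-mono : ∀ {m n} → m ℕ.≤ n → fromℕ m ≤ fromℕ n
  fromℕ-mono {m} m≤n with d , refl ← ℕ.m≤n⇒∃[o]m+o≡n m≤n = begin
    fromℕ m               ≡⟨ +-identityʳ (fromℕ m) ⟨
    fromℕ m + 0ℚ          ≤⟨ +-monoʳ-≤ (fromℕ m) (fromℕ-nonneg d) ⟩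
    fromℕ m + fromℕ d     ≡⟨ fromℕ-+ m d ⟨
    fromℕ (m ℕ.+ d)       ∎
    where open ≤-Reasoning

  fromℕ-pos⁻¹ : ∀ m → 0ℚ < fromℕ m → 1 ℕ.≤ m
  fromℕ-pos⁻¹ zero    0<0 = contradiction 0<0 (<-irrefl refl)
  fromℕ-pos⁻¹ (suc m) _   = ℕ.s≤s ℕ.z≤n

  //-nonneg : ∀ m n → 0ℚ ≤ m // n
  //-nonneg m zero    = ≤-refl
  //-nonneg m (suc n) = nonNegative⁻¹ (m // suc n) {{normalize-nonNeg m (suc n)}}

  //-*-cancel : ∀ m n → (m // suc n) * fromℕ (suc n) ≡ fromℕ m
  //-*-cancel m n = toℚᵘ-injective (ℚᵘ.≃-trans (toℚᵘ-homo-* (m // suc n) (fromℕ (suc n)))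
    (ℚᵘ.≃-trans (ℚᵘ.*-cong (toℚᵘ-fromℚᵘ (ℚᵘ.mkℚᵘ (+ m) n)) (toℚᵘ-fromℚᵘ (ℚᵘ.mkℚᵘ (+ suc n) 0)))
    (ℚᵘ.≃-trans (ℚᵘ.*≡* cross) (ℚᵘ.≃-sym (toℚᵘ-fromℚᵘ (ℚᵘ.mkℚᵘ (+ m) 0))))))
    where
    cross : (+ m ℤ.* + suc n) ℤ.* + 1 ≡ + m ℤ.* (+ (suc n ℕ.* 1))
    cross = trans (ℤ.*-identityʳ _) (cong (λ d → + m ℤ.* + d) (sym (ℕ.*-identityʳ (suc n))))

  //≤1 : ∀ m n → m ℕ.≤ n → m // n ≤ 1ℚ
  //≤1 m zero    _   = *≤* (ℤ.+≤+ ℕ.z≤n)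
  //≤1 m (suc n) m≤n = *-cancelʳ-≤-pos (fromℕ (suc n)) {{positive (fromℕ-pos n)}}
    (≤-trans (≤-reflexive (//-*-cancel m n)) (≤-trans (fromℕ-mono m≤n) (≤-reflexive (sym (*-identityˡ _)))))

  *-monoʳ-≤-nonneg : ∀ {r p q} → 0ℚ ≤ r → p ≤ q → r * p ≤ r * q
  *-monoʳ-≤-nonneg {r} 0≤r = *-monoˡ-≤-nonNeg r {{nonNegative 0≤r}}

  *-monoˡ-≤-nonneg : ∀ {r p q} → 0ℚ ≤ r → p ≤ q → p * r ≤ q * r
  *-monoˡ-≤-nonneg {r} 0≤r = *-monoʳ-≤-nonNeg r {{nonNegative 0≤r}}

  *-cancelˡ-≤-pos′ : ∀ {r p q} → 0ℚ < r → r * p ≤ r * q → p ≤ q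
  *-cancelˡ-≤-pos′ {r} 0<r = *-cancelˡ-≤-pos r {{positive 0<r}}

  *-nonneg : ∀ {p q} → 0ℚ ≤ p → 0ℚ ≤ q → 0ℚ ≤ p * q
  *-nonneg {p} {q} 0≤p 0≤q = nonNegative⁻¹ _ {{nonNeg*nonNeg⇒nonNeg p {{nonNegative 0≤p}} q {{nonNegative 0≤q}}}}

  *-pos : ∀ {p q} → 0ℚ < p → 0ℚ < q → 0ℚ < p * q
  *-pos {p} {q} 0<p 0<q = positive⁻¹ _ {{pos*pos⇒pos p {{positive 0<p}} q {{positive 0<q}}}}

  ^ℚ-nonneg : ∀ {x} i → 0ℚ ≤ x → 0ℚ ≤ x ^ℚ i
  ^ℚ-nonneg zero    0≤x = *≤* (ℤ.+≤+ ℕ.z≤n)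
  ^ℚ-nonneg (suc i) 0≤x = *-nonneg 0≤x (^ℚ-nonneg i 0≤x)

  ^ℚ-pos : ∀ {x} i → 0ℚ < x → 0ℚ < x ^ℚ i
  ^ℚ-pos zero    0<x = *<* (ℤ.+<+ (ℕ.s≤s ℕ.z≤n))
  ^ℚ-pos (suc i) 0<x = *-pos 0<x (^ℚ-pos i 0<x)

  ^ℚ-mono : ∀ {x y} i → 0ℚ ≤ x → x ≤ y → x ^ℚ i ≤ y ^ℚ i
  ^ℚ-mono zero    0≤x x≤y = ≤-refl
  ^ℚ-mono (suc i) 0≤x x≤y =
    ≤-trans (*-monoˡ-≤-nonneg (^ℚ-nonneg i 0≤x) x≤y) (*-monoʳ-≤-nonneg (≤-trans 0≤x x≤y) (^ℚ-mono i 0≤x x≤y))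

  ^ℚ-distrib-* : ∀ x y i → (x * y) ^ℚ i ≡ x ^ℚ i * y ^ℚ i
  ^ℚ-distrib-* x y zero = refl
  ^ℚ-distrib-* x y (suc i) rewrite ^ℚ-distrib-* x y i =
    solve 4 (λ x y a b → (x :* y) :* (a :* b) := (x :* a) :* (y :* b)) refl x y (x ^ℚ i) (y ^ℚ i)

  1^ℚ : ∀ i → 1ℚ ^ℚ i ≡ 1ℚ
  1^ℚ zero    = refl
  1^ℚ (suc i) rewrite 1^ℚ i = refl

  ∑ℚ : (A → ℚ) → List A → ℚ
  ∑ℚ f = foldr (λ x s → f x + s) 0ℚ

  ∑ℚ-cong : ∀ {f g : A → ℚ} xs → (∀ x → f x ≡ g x) → ∑ℚ f xs ≡ ∑ℚ g xs
  ∑ℚ-cong []       h = refl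
  ∑ℚ-cong (x ∷ xs) h = cong₂ _+_ (h x) (∑ℚ-cong xs h)

  ∑ℚ-mono : ∀ {f g : A → ℚ} xs → (∀ {x} → x ∈ xs → f x ≤ g x) → ∑ℚ f xs ≤ ∑ℚ g xs
  ∑ℚ-mono []       h = ≤-refl
  ∑ℚ-mono (x ∷ xs) h = +-mono-≤ (h (here refl)) (∑ℚ-mono xs (h ∘ there))

  ∑ℚ-nonneg : ∀ {f : A → ℚ} xs → (∀ {x} → x ∈ xs → 0ℚ ≤ f x) → 0ℚ ≤ ∑ℚ f xs
  ∑ℚ-nonneg []       h = ≤-refl
  ∑ℚ-nonneg (x ∷ xs) h = +-mono-≤ (h (here refl)) (∑ℚ-nonneg xs (h ∘ there))

  ∑ℚ-≥-term : ∀ {f : A → ℚ} xs {x} → (∀ {y} → y ∈ xs → 0ℚ ≤ f y) → x ∈ xs → f x ≤ ∑ℚ f xs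
  ∑ℚ-≥-term {f = f} (y ∷ xs) h (here refl) =
    ≤-trans (≤-reflexive (sym (+-identityʳ (f y)))) (+-monoʳ-≤ (f y) (∑ℚ-nonneg xs (h ∘ there)))
  ∑ℚ-≥-term {f = f} (y ∷ xs) h (there x∈) =
    ≤-trans (≤-reflexive (sym (+-identityˡ _))) (+-mono-≤ (h (here refl)) (∑ℚ-≥-term xs (h ∘ there) x∈))

  ∑ℚ-*ʳ : ∀ (f : A → ℚ) c xs → ∑ℚ (λ x → f x * c) xs ≡ ∑ℚ f xs * c
  ∑ℚ-*ʳ f c []       = sym (*-zeroˡ c)
  ∑ℚ-*ʳ f c (x ∷ xs) rewrite ∑ℚ-*ʳ f c xs = sym (*-distribʳ-+ c (f x) (∑ℚ f xs))

  ∑ℚ-difference : ∀ (f g : A → ℚ) xs → ∑ℚ (λ x → f x - g x) xs ≡ ∑ℚ f xs - ∑ℚ g xs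
  ∑ℚ-difference f g []       = refl
  ∑ℚ-difference f g (x ∷ xs) rewrite ∑ℚ-difference f g xs =
    solve 4 (λ a b c d → (a :- b) :+ (c :- d) := (a :+ c) :- (b :+ d)) refl (f x) (g x) (∑ℚ f xs) (∑ℚ g xs)

  fromℕ-∑ : ∀ (f : A → ℕ) xs → fromℕ (∑ f xs) ≡ ∑ℚ (fromℕ ∘ f) xs
  fromℕ-∑ f []       = refl
  fromℕ-∑ f (x ∷ xs) rewrite fromℕ-+ (f x) (∑ f xs) | fromℕ-∑ f xs = refl

  ∑ℚ-const : ∀ c (xs : List A) → ∑ℚ (λ _ → c) xs ≡ fromℕ (length xs) * c
  ∑ℚ-const c []       = sym (*-zeroˡ c)
  ∑ℚ-const c (x ∷ xs) rewrite ∑ℚ-const c xs | fromℕ-suc (length xs) =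
    solve 2 (λ c l → c :+ l :* c := (con 1ℚ :+ l) :* c) refl c (fromℕ (length xs))

  *-∑-bound : ∀ {c : ℚ} (a : ℚ) (f : A → ℕ) xs → 0ℚ ≤ a → (∀ {x} → x ∈ xs → a * fromℕ (f x) ≤ c) →
              a * fromℕ (∑ f xs) ≤ fromℕ (length xs) * c
  *-∑-bound {c = c} a f xs 0≤a bounded = begin
    a * fromℕ (∑ f xs)            ≡⟨ cong (a *_) (fromℕ-∑ f xs) ⟩
    a * ∑ℚ (fromℕ ∘ f) xs         ≡⟨ *-comm a _ ⟩
    ∑ℚ (fromℕ ∘ f) xs * a         ≡⟨ ∑ℚ-*ʳ (fromℕ ∘ f) a xs ⟨
    ∑ℚ (λ x → fromℕ (f x) * a) xs ≤⟨ ∑ℚ-mono xs (λ {x} x∈ → ≤-trans (≤-reflexive (*-comm (fromℕ (f x)) a)) (bounded x∈)) ⟩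
    ∑ℚ (λ _ → c) xs               ≡⟨ ∑ℚ-const c xs ⟩
    fromℕ (length xs) * c         ∎
    where open ≤-Reasoning

module Bound where

  open import Data.Nat.Base as ℕ using (ℕ; zero; suc; _∸_)
  import Data.Nat.Properties as ℕ
  open import Data.Rational.Base using (ℚ; 0ℚ; 1ℚ; _+_; _*_; _-_; -_; _⊓_; _≤_; _<_; nonNegative; positive)
  open import Data.Rational.Properties
  open import Data.Rational.Solver using (module +-*-Solver)
  open +-*-Solver
  open import Relation.Nullary using (contradiction)
  open import Relation.Binary.Definitions using (tri<; tri≈; tri>)
  open import Relation.Binary.PropositionalEquality using (_≡_; refl; sym; trans; cong; cong₂; module ≡-Reasoning)
  open import Defs using (fromℕ; _//_; _^ℚ_; Xterm; Aterm)
  open Rationals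

  -- Since min{1, |I|/(k-i)} ≥ 1/(k-i) as soon as |I| ≥ 1, the factor 1 + (k-1) min{…} is at least k/(k-i).
  Xterm-lower-bound : ∀ Δ π k sI i N → 1 ℕ.≤ sI → i ℕ.< k →
    (k ∸ i) ℕ.* N ℕ.≤ Δ ℕ.* (k ℕ.* (Δ ∸ 1) ℕ.* π) → fromℕ N ≤ Xterm Δ π k sI i
  Xterm-lower-bound Δ π k sI i N 1≤sI i<k counted with k ∸ i in k-i≡
  ... | zero   = contradiction (ℕ.m∸n≡0⇒m≤n k-i≡) (ℕ.<⇒≱ i<k)
  ... | suc K′ = *-cancelˡ-≤-pos′ (fromℕ-pos K′) (begin
    fromℕ K * fromℕ N                              ≡⟨ fromℕ-* K N ⟨
    fromℕ (K ℕ.* N)                                ≤⟨ fromℕ-mono counted ⟩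
    fromℕ (Δ ℕ.* (k ℕ.* (Δ ∸ 1) ℕ.* π))            ≡⟨ cong fromℕ (rearrange Δ k π (Δ ∸ 1)) ⟩
    fromℕ (Δ ℕ.* (Δ ∸ 1) ℕ.* π ℕ.* k)              ≡⟨ fromℕ-* (Δ ℕ.* (Δ ∸ 1) ℕ.* π) k ⟩
    P * fromℕ k                                    ≤⟨ *-monoʳ-≤-nonneg (fromℕ-nonneg (Δ ℕ.* (Δ ∸ 1) ℕ.* π)) k≤ ⟩
    P * (fromℕ K * (1ℚ + fromℕ (k ∸ 1) * μ))        ≡⟨ solve 3 (λ p a b → p :* (a :* b) := a :* (p :* b)) refl P (fromℕ K) _ ⟩
    fromℕ K * (P * (1ℚ + fromℕ (k ∸ 1) * μ))        ∎)
    where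
    open ≤-Reasoning
    K = suc K′
    P = fromℕ (Δ ℕ.* (Δ ∸ 1) ℕ.* π)
    μ = 1ℚ ⊓ (sI // K)
    rearrange : ∀ d k p e → d ℕ.* (k ℕ.* e ℕ.* p) ≡ d ℕ.* e ℕ.* p ℕ.* k
    rearrange d k p e = trans (cong (d ℕ.*_) (trans (ℕ.*-assoc k e p) (ℕ.*-comm k (e ℕ.* p))))
                              (trans (sym (ℕ.*-assoc d (e ℕ.* p) k)) (cong (ℕ._* k) (sym (ℕ.*-assoc d e p))))
    K*sI/K≡sI : fromℕ K * (sI // K) ≡ fromℕ sI
    K*sI/K≡sI = trans (*-comm (fromℕ K) _) (//-*-cancel sI K′)
    1≤Kμ : 1ℚ ≤ fromℕ K * μ
    1≤Kμ = begin
      1ℚ                                     ≤⟨ ⊓-glb (≤-trans (fromℕ-mono {1} {K} (ℕ.s≤s ℕ.z≤n)) (≤-reflexive (sym (*-identityʳ (fromℕ K)))))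
                                                      (≤-trans (fromℕ-mono 1≤sI) (≤-reflexive (sym K*sI/K≡sI))) ⟩
      (fromℕ K * 1ℚ) ⊓ (fromℕ K * (sI // K)) ≡⟨ *-distribˡ-⊓-nonNeg (fromℕ K) {{nonNegative (fromℕ-nonneg K)}} 1ℚ (sI // K) ⟨
      fromℕ K * μ                            ∎
    k≤ : fromℕ k ≤ fromℕ K * (1ℚ + fromℕ (k ∸ 1) * μ)
    k≤ = begin
      fromℕ k                                   ≤⟨ fromℕ-mono (ℕ.≤-trans (ℕ.m≤n+m∸n k 1) (ℕ.+-monoˡ-≤ (k ∸ 1) {1} {K} (ℕ.s≤s ℕ.z≤n))) ⟩
      fromℕ (K ℕ.+ (k ∸ 1))                     ≡⟨ fromℕ-+ K (k ∸ 1) ⟩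
      fromℕ K + fromℕ (k ∸ 1)                   ≡⟨ cong (fromℕ K +_) (*-identityʳ (fromℕ (k ∸ 1))) ⟨
      fromℕ K + fromℕ (k ∸ 1) * 1ℚ              ≤⟨ +-monoʳ-≤ (fromℕ K) (*-monoʳ-≤-nonneg (fromℕ-nonneg (k ∸ 1)) 1≤Kμ) ⟩
      fromℕ K + fromℕ (k ∸ 1) * (fromℕ K * μ)
        ≡⟨ solve 3 (λ a b c → a :+ b :* (a :* c) := a :* (con 1ℚ :+ b :* c)) refl (fromℕ K) (fromℕ (k ∸ 1)) μ ⟩
      fromℕ K * (1ℚ + fromℕ (k ∸ 1) * μ)        ∎

  nonneg-*-pos⇒pos : ∀ {b y} → 0ℚ ≤ b → 0ℚ < b * y → 0ℚ < b
  nonneg-*-pos⇒pos {b} {y} 0≤b 0<by with <-cmp 0ℚ b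
  ... | tri< 0<b _ _ = 0<b
  ... | tri≈ _ 0≡b _ = contradiction (≤-<-trans (≤-reflexive (trans (cong (_* y) (sym 0≡b)) (*-zeroˡ y))) 0<by) (<-irrefl refl)
  ... | tri> _ _ b<0 = contradiction (<-≤-trans b<0 0≤b) (<-irrefl refl)

  -- Dividing β^(j+1) T ≤ N c ≤ X c ≤ b^(j+2) c / p by b^(j+1) ≤ β^(j+1).
  geometric-cancel : ∀ j {b β p X N T c : ℚ} → 0ℚ ≤ b → b ≤ β → 0ℚ < p → p * X ≤ b ^ℚ suc (suc j) →
    0ℚ < N → N ≤ X → 0ℚ ≤ T → 0ℚ ≤ c → β ^ℚ suc j * T ≤ N * c → p * T ≤ b * c
  geometric-cancel j {b} {β} {p} {X} {N} {T} {c} 0≤b b≤β 0<p pX≤ 0<N N≤X 0≤T 0≤c counted =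
    *-cancelˡ-≤-pos′ (^ℚ-pos (suc j) 0<b) (begin
      b ^ℚ suc j * (p * T)     ≡⟨ solve 3 (λ a p t → a :* (p :* t) := p :* (a :* t)) refl (b ^ℚ suc j) p T ⟩
      p * (b ^ℚ suc j * T)     ≤⟨ *-monoʳ-≤-nonneg 0≤p (*-monoˡ-≤-nonneg 0≤T (^ℚ-mono (suc j) 0≤b b≤β)) ⟩
      p * (β ^ℚ suc j * T)     ≤⟨ *-monoʳ-≤-nonneg 0≤p counted ⟩
      p * (N * c)              ≤⟨ *-monoʳ-≤-nonneg 0≤p (*-monoˡ-≤-nonneg 0≤c N≤X) ⟩
      p * (X * c)              ≡⟨ *-assoc p X c ⟨
      p * X * c                ≤⟨ *-monoˡ-≤-nonneg 0≤c pX≤ ⟩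
      b * b ^ℚ suc j * c       ≡⟨ solve 3 (λ b a c → b :* a :* c := a :* (b :* c)) refl b (b ^ℚ suc j) c ⟩
      b ^ℚ suc j * (b * c)     ∎)
    where
    open ≤-Reasoning
    0≤p = <⇒≤ 0<p
    0<b : 0ℚ < b
    0<b = nonneg-*-pos⇒pos 0≤b (<-≤-trans (*-pos 0<p (<-≤-trans 0<N N≤X)) pX≤)

  module _ (j : ℕ) where
    private
      p w u : ℚ
      p = fromℕ (suc j)
      w = suc j // suc (suc j)
      u = suc (suc j) // suc j

      w*[1+p]≡p : w * (1ℚ + p) ≡ p
      w*[1+p]≡p = trans (cong (w *_) (sym (fromℕ-suc (suc j)))) (//-*-cancel (suc j) (suc j))

      u*p≡1+p : u * p ≡ 1ℚ + p
      u*p≡1+p = trans (//-*-cancel (suc (suc j)) j) (fromℕ-suc (suc j))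

      0<p[1+p] : 0ℚ < p * (1ℚ + p)
      0<p[1+p] = *-pos (fromℕ-pos j) (<-≤-trans (fromℕ-pos j) (≤-trans (≤-reflexive (sym (+-identityˡ p))) (+-monoˡ-≤ p (fromℕ-nonneg 1))))

      u*w≡1 : u * w ≡ 1ℚ
      u*w≡1 = ≤-antisym (*-cancelʳ-≤-pos (p * (1ℚ + p)) {{positive 0<p[1+p]}} (≤-reflexive scaled))
                        (*-cancelʳ-≤-pos (p * (1ℚ + p)) {{positive 0<p[1+p]}} (≤-reflexive (sym scaled)))
        where
        scaled : u * w * (p * (1ℚ + p)) ≡ 1ℚ * (p * (1ℚ + p))
        scaled = begin
          u * w * (p * (1ℚ + p))     ≡⟨ solve 4 (λ u w p q → u :* w :* (p :* q) := (u :* p) :* (w :* q)) refl u w p (1ℚ + p) ⟩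
          (u * p) * (w * (1ℚ + p))   ≡⟨ cong₂ _*_ u*p≡1+p w*[1+p]≡p ⟩
          (1ℚ + p) * p               ≡⟨ solve 2 (λ p q → q :* p := con 1ℚ :* (p :* q)) refl p (1ℚ + p) ⟩
          1ℚ * (p * (1ℚ + p))        ∎
          where open ≡-Reasoning

      0≤w : 0ℚ ≤ w
      0≤w = //-nonneg (suc j) (suc (suc j))

    -- A_i ≤ r^i says exactly that (i-1) X_i ≤ (r (i-1)/i)^i.
    Aterm-bound : ∀ {Δ π k sI r} → Aterm Δ π k sI (suc (suc j)) ≤ r ^ℚ suc (suc j) →
      p * Xterm Δ π k sI (suc (suc j)) ≤ (r * w) ^ℚ suc (suc j)
    Aterm-bound {Δ} {π} {k} {sI} {r} A≤rⁱ = begin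
      p * X                          ≡⟨ solve 2 (λ p x → p :* x := con 1ℚ :* p :* x) refl p X ⟩
      1ℚ * p * X                     ≡⟨ cong (λ z → z * p * X) (trans (cong (_^ℚ i) u*w≡1) (1^ℚ i)) ⟨
      (u * w) ^ℚ i * p * X           ≡⟨ cong (λ z → z * p * X) (^ℚ-distrib-* u w i) ⟩
      u ^ℚ i * w ^ℚ i * p * X        ≡⟨ solve 4 (λ a b p x → a :* b :* p :* x := a :* p :* x :* b) refl (u ^ℚ i) (w ^ℚ i) p X ⟩
      Aterm Δ π k sI i * w ^ℚ i      ≤⟨ *-monoˡ-≤-nonneg (^ℚ-nonneg i 0≤w) A≤rⁱ ⟩
      r ^ℚ i * w ^ℚ i                ≡⟨ ^ℚ-distrib-* r w i ⟨
      (r * w) ^ℚ i                   ∎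
      where
      open ≤-Reasoning
      i = suc (suc j)
      X = Xterm Δ π k sI i

    share-identity : ∀ r → r * w ≡ p * (r - r * w)
    share-identity r = begin
      r * w                          ≡⟨ solve 3 (λ r w p → r :* w := r :* (w :* (con 1ℚ :+ p) :- p :* w)) refl r w p ⟩
      r * (w * (1ℚ + p) - p * w)     ≡⟨ cong (λ z → r * (z - p * w)) w*[1+p]≡p ⟩
      r * (p - p * w)                ≡⟨ solve 3 (λ r p w → r :* (p :- p :* w) := p :* (r :- r :* w)) refl r p w ⟩
      p * (r - r * w)                ∎
      where open ≡-Reasoning

  pivot-class-bound : ∀ {Δ π k sI} i {r β N T c : ℚ} → 1 ℕ.≤ i → 0ℚ ≤ r → r * ((i ∸ 1) // i) ≤ β →
    Aterm Δ π k sI i ≤ r ^ℚ i → 0ℚ < N → N ≤ Xterm Δ π k sI i → 0ℚ ≤ T → 0ℚ ≤ c →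
    β ^ℚ (i ∸ 1) * T ≤ N * c → T ≤ (r - r * ((i ∸ 1) // i)) * c
  pivot-class-bound {Δ} {π} {k} {sI} (suc zero) {r} {β} {N} {T} {c} _ _ _ A≤r _ N≤X _ 0≤c counted = begin
    T                     ≡⟨ *-identityˡ T ⟨
    1ℚ * T                ≤⟨ counted ⟩
    N * c                 ≤⟨ *-monoˡ-≤-nonneg 0≤c N≤X ⟩
    Xterm Δ π k sI 1 * c  ≤⟨ *-monoˡ-≤-nonneg 0≤c (≤-trans A≤r (≤-reflexive (*-identityʳ r))) ⟩
    r * c                 ≡⟨ cong (_* c) (solve 1 (λ r → r := r :- r :* con 0ℚ) refl r) ⟩
    (r - r * 0ℚ) * c      ∎
    where open ≤-Reasoning
  pivot-class-bound {Δ} {π} {k} {sI} (suc (suc j)) {r} {β} {N} {T} {c} _ 0≤r b≤β A≤rⁱ 0<N N≤X 0≤T 0≤c counted =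
    *-cancelˡ-≤-pos′ (fromℕ-pos j) (begin
      fromℕ (suc j) * T                   ≤⟨ geometric-cancel j 0≤b b≤β (fromℕ-pos j) pX≤bⁱ 0<N N≤X 0≤T 0≤c counted ⟩
      r * w * c                           ≡⟨ cong (_* c) (share-identity j r) ⟩
      fromℕ (suc j) * (r - r * w) * c     ≡⟨ *-assoc (fromℕ (suc j)) _ c ⟩
      fromℕ (suc j) * ((r - r * w) * c)   ∎)
    where
    open ≤-Reasoning
    w = suc j // suc (suc j)
    0≤b = *-nonneg 0≤r (//-nonneg (suc j) (suc (suc j)))
    pX≤bⁱ = Aterm-bound j {Δ} {π} {k} {sI} {r} A≤rⁱ

module CountingArgument {n m k : ℕ} (H : SeqHypergraph n m k) (Π : PermSet k) (L : Fin n → List ℕ)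
  (L-unique : ∀ v → Unique (L v)) {Δ : ℕ} (deg≤Δ : ∀ v → deg H v ℕ.≤ Δ) {R : ℕ} (R≤∣L∣ : ∀ v → R ℕ.≤ length (L v))
  (bound : BoundHolds H Δ (length (PermSet.perms Π)) R) where

  open import Level using (0ℓ)
  open import Data.Bool.Base using (true; false; if_then_else_)
  open import Data.Nat.Base as ℕ using (ℕ; _∸_)
  import Data.Nat.Properties as ℕ
  open import Data.Rational.Base using (ℚ; 0ℚ; _+_; _*_; _-_; -_; _≤_; _<_)
  open import Data.Rational.Properties
  open import Data.Rational.Solver using (module +-*-Solver)
  open +-*-Solver
  open import Data.Fin.Base using (Fin)
  open import Data.Fin.Subset using (Subset; ⊤; ⊥; _∪_; ⁅_⁆; _⊆_; _⊂_) renaming (_∉_ to _∉ˢ_)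
  open import Data.Fin.Subset.Properties using (∈⊤; ∉⊥; x∈p∪q⁺; x∈⁅x⁆; p⊆p∪q; ⊆-antisym; ⊆-reflexive)
  open import Data.Fin.Subset.Induction using (⊂-wellFounded)
  open import Induction.WellFounded using (module All)
  open import Data.Vec.Base using (lookup)
  open import Data.List.Base using (List; []; _∷_; length; allFin)
  open import Data.List.Membership.Propositional using (_∈_)
  open import Data.List.Membership.Propositional.Properties using (∈-allFin; ∈-filter⁻)
  open import Data.List.Relation.Unary.Any using (here; there)
  open import Data.List.Relation.Unary.All.Properties using (All¬⇒¬Any)
  open import Data.List.Relation.Unary.AllPairs using (_∷_)
  open import Data.List.Relation.Unary.Unique.Propositional using (Unique)
  import Data.List.Relation.Unary.Unique.Propositional.Properties as Unique
  open import Data.Product.Base using (Σ; _×_; _,_; proj₁; proj₂)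
  open import Data.Sum.Base using (inj₁; inj₂)
  open import Function.Base using (_∘_)
  open import Relation.Binary.PropositionalEquality using (_≡_; refl; sym; cong; subst; subst₂; module ≡-Reasoning)
  open import Defs
  open Counting
  open Subsets
  open Hypergraph
  open Rationals
  open Bound

  open PartialColourings H Π L

  r : ℕ → ℚ
  r = proj₁ bound

  0≤r : ∀ i → 1 ℕ.≤ i → i ℕ.< k → 0ℚ ≤ r i
  0≤r = proj₁ (proj₂ bound)

  A≤rⁱ : ∀ i → inI H i ≡ true → Aterm Δ (length (PermSet.perms Π)) k (sizeI H) i ≤ r i ^ℚ i
  A≤rⁱ = proj₁ (proj₂ (proj₂ bound))

  ∑r<R : ∑ℚ (λ i → if inI H i then r i else 0ℚ) indices < fromℕ R
  ∑r<R = proj₂ (proj₂ (proj₂ bound))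

  -- Opaque, so that unification never unfolds the gcd normalisation hidden in fromℕ.
  opaque
    C : Subset n → ℚ
    C S = fromℕ (properCount S)

    C≡fromℕ : ∀ S → C S ≡ fromℕ (properCount S)
    C≡fromℕ S = refl

  C-nonneg : ∀ S → 0ℚ ≤ C S
  C-nonneg S = ≤-trans (fromℕ-nonneg (properCount S)) (≤-reflexive (sym (C≡fromℕ S)))

  onI : (ℕ → ℚ) → ℕ → ℚ
  onI f i = if inI H i then f i else 0ℚ

  -- r_i splits into share i = r_i (i − 1)/i, which absorbs the factor β^(i − 1) of a pivot class, and loss i = r_i / i.
  share : ℕ → ℚ
  share i = r i * ((i ∸ 1) // i)

  loss : ℕ → ℚ
  loss = onI λ i → r i - share i

  β : ℚ
  β = fromℕ R - ∑ℚ loss indices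

  slack : ℚ
  slack = fromℕ R - ∑ℚ (onI r) indices

  0<slack : 0ℚ < slack
  0<slack = ≤-<-trans (≤-reflexive (sym (+-inverseʳ (∑ℚ (onI r) indices)))) (+-monoˡ-< (- ∑ℚ (onI r) indices) ∑r<R)

  β≡slack+shares : β ≡ slack + ∑ℚ (onI share) indices
  β≡slack+shares = begin
    fromℕ R - ∑ℚ loss indices                                      ≡⟨ cong (λ s → fromℕ R - s) (∑ℚ-cong indices split) ⟩
    fromℕ R - ∑ℚ (λ i → onI r i - onI share i) indices             ≡⟨ cong (λ s → fromℕ R - s) (∑ℚ-difference (onI r) (onI share) indices) ⟩
    fromℕ R - (∑ℚ (onI r) indices - ∑ℚ (onI share) indices)
      ≡⟨ solve 3 (λ x y z → x :- (y :- z) := (x :- y) :+ z) refl (fromℕ R) _ _ ⟩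
    slack + ∑ℚ (onI share) indices                                 ∎
    where
    open ≡-Reasoning
    split : ∀ i → loss i ≡ onI r i - onI share i
    split i with inI H i
    ... | true  = refl
    ... | false = refl

  0≤share : ∀ {i} → i ∈ indices → 0ℚ ≤ onI share i
  0≤share {i} i∈ with inI H i | ∈-indices⁻ i∈
  ... | true  | 1≤i , i<k = *-nonneg (0≤r i 1≤i i<k) (//-nonneg (i ∸ 1) i)
  ... | false | _         = ≤-refl

  slack≤β : slack ≤ β
  slack≤β = ≤-trans (≤-reflexive (sym (+-identityʳ slack)))
                    (≤-trans (+-monoʳ-≤ slack (∑ℚ-nonneg indices 0≤share)) (≤-reflexive (sym β≡slack+shares)))

  0<β : 0ℚ < β
  0<β = <-≤-trans 0<slack slack≤β

  share≤β : ∀ {i} → i ∈ indices → inI H i ≡ true → share i ≤ β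
  share≤β {i} i∈ i∈I = begin
    share i                           ≡⟨ cong (λ b → if b then share i else 0ℚ) i∈I ⟨
    onI share i                       ≤⟨ ∑ℚ-≥-term indices 0≤share i∈ ⟩
    ∑ℚ (onI share) indices            ≡⟨ +-identityˡ _ ⟨
    0ℚ + ∑ℚ (onI share) indices       ≤⟨ +-monoˡ-≤ _ (<⇒≤ 0<slack) ⟩
    slack + ∑ℚ (onI share) indices    ≡⟨ β≡slack+shares ⟨
    β                                 ∎
    where open ≤-Reasoning

  0≤loss : ∀ {i} → i ∈ indices → 0ℚ ≤ loss i
  0≤loss {i} i∈ with inI H i | ∈-indices⁻ i∈
  ... | true  | 1≤i , i<k = ≤-trans (≤-reflexive (sym (+-inverseʳ (share i)))) (+-monoˡ-≤ (- share i) share≤r)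
    where
    share≤r : share i ≤ r i
    share≤r = ≤-trans (*-monoʳ-≤-nonneg (0≤r i 1≤i i<k) (//≤1 (i ∸ 1) i (ℕ.m∸n≤m i 1))) (≤-reflexive (*-identityʳ (r i)))
  ... | false | _         = ≤-refl

  Grows : Subset n → Set
  Grows S = ∀ v → v ∉ˢ S → β * C S ≤ C (S ∪ ⁅ v ⁆)

  grows-along : ∀ {S} → (∀ {B} → B ⊂ S → Grows B) → ∀ {B} ws → Unique ws → (∀ {w} → w ∈ ws → w ∉ˢ B) →
                insertAll B ws ⊆ S → β ^ℚ length ws * C B ≤ C (insertAll B ws)
  grows-along grows []               _             _     _   = ≤-reflexive (*-identityˡ _)
  grows-along grows {B} (w ∷ ws) (w∉ws ∷ unique) fresh ⊆S = begin
    β * β ^ℚ length ws * C B          ≡⟨ *-assoc β _ (C B) ⟩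
    β * (β ^ℚ length ws * C B)        ≤⟨ *-monoʳ-≤-nonneg (<⇒≤ 0<β) (grows-along grows ws unique (fresh ∘ there) (⊆S ∘ p⊆p∪q ⁅ w ⁆)) ⟩
    β * C (insertAll B ws)            ≤⟨ grows (⊆S ∘ p⊆p∪q ⁅ w ⁆ , w , ⊆S (x∈p∪q⁺ (inj₂ (x∈⁅x⁆ w))) , w∉B′) w w∉B′ ⟩
    C (insertAll B ws ∪ ⁅ w ⁆)        ∎
    where
    open ≤-Reasoning
    w∉B′ : w ∉ˢ insertAll B ws
    w∉B′ w∈ with ∈-insertAll⁻ B ws w∈
    ... | inj₁ w∈B  = fresh (here refl) w∈B
    ... | inj₂ w∈ws = All¬⇒¬Any w∉ws w∈ws

  module Extension (S : Subset n) (smaller : ∀ {B} → B ⊂ S → Grows B) (v : Fin n) (v∉S : v ∉ˢ S) where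
    open Step S v v∉S

    -- Removing the released vertices of a pivot and adding them back one at a time gains a factor β each time.
    pivot-chain : ∀ {i t} → t ∈ pivots i → β ^ℚ (i ∸ 1) * C (base t) ≤ C S
    pivot-chain {i} {t@(e , e′ , σ)} t∈ = subst₂ (λ l S′ → β ^ℚ l * C (base t) ≤ C S′) (cong (_∸ 1) length-released) insertAll-base
      (grows-along smaller (released t) released-unique (λ w∈ w∈B → proj₂ (∈-removeAll⁻ S (released t) w∈B) w∈)
        (⊆-reflexive insertAll-base))
      where open Encoding {i} {e} {e′} {σ} (proj₂ (∈-filter⁻ (pivot? i) {xs = triples} t∈))

    class-total : ℕ → ℕ
    class-total i = ∑[ t ← pivots i ] properCount (base t)

    class-bound : ∀ {i} → i ∈ indices → fromℕ (class-total i) ≤ loss i * C S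
    class-bound {i} i∈ = bound-for (pivots i) (λ t∈ → t∈) (pivots-count deg≤Δ i)
      where
      1≤i = proj₁ (∈-indices⁻ i∈)
      i<k = proj₂ (∈-indices⁻ i∈)
      bound-for : ∀ ts → (∀ {t} → t ∈ ts → t ∈ pivots i) →
                  (k ∸ i) ℕ.* length ts ℕ.≤ Δ ℕ.* (k ℕ.* (Δ ∸ 1) ℕ.* length (PermSet.perms Π)) →
                  fromℕ (∑ (properCount ∘ base) ts) ≤ loss i * C S
      bound-for []           _         _       = *-nonneg (0≤loss i∈) (C-nonneg S)
      bound-for ts@(_ ∷ ts′) ⊆pivots counted = subst (λ b → T ≤ (if b then r i - share i else 0ℚ) * C S) (sym i∈I)
        (pivot-class-bound {Δ} {π} {k} {sizeI H} i {r i} {β} {fromℕ (length ts)} {T} {C S}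
          1≤i (0≤r i 1≤i i<k) (share≤β i∈ i∈I) (A≤rⁱ i i∈I) (fromℕ-pos (length ts′))
          (Xterm-lower-bound Δ π k (sizeI H) i (length ts) (1≤sizeI H i<k i∈I) i<k counted)
          (fromℕ-nonneg (∑ (properCount ∘ base) ts)) (C-nonneg S)
          (*-∑-bound (β ^ℚ (i ∸ 1)) (properCount ∘ base) ts (^ℚ-nonneg (i ∸ 1) (<⇒≤ 0<β))
            (λ {t} t∈ → subst (λ z → β ^ℚ (i ∸ 1) * z ≤ C S) (C≡fromℕ (base t)) (pivot-chain (⊆pivots t∈)))))
        where
        π = length (PermSet.perms Π)
        T = fromℕ (∑ (properCount ∘ base) ts)
        i∈I = pivots-inI i∈ (⊆pivots (here refl))

    extension-bound : length (L v) ℕ.* properCount S ℕ.≤ properCount S⁺ ℕ.+ ∑ class-total indices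
    extension-bound = ℕ.≤-trans extension-count (ℕ.+-monoʳ-≤ (properCount S⁺)
      (ℕ.≤-trans (∑-mono allPivots per-pivot) (ℕ.≤-reflexive (∑-concatMap (properCount ∘ base) pivots indices))))
      where
      per-pivot : ∀ {t} → t ∈ allPivots → tally (spoiledAt? t) (colourings S⁺) ℕ.≤ properCount (base t)
      per-pivot {e , e′ , σ} t∈ with i , _ , pivot ← ∈-allPivots⁻ t∈ = Encoding.spoiledAt-count {i} {e} {e′} {σ} pivot L-unique

    grows-by-β : β * C S ≤ C S⁺
    grows-by-β = begin
      β * C S
        ≡⟨ solve 3 (λ a l c → (a :- l) :* c := a :* c :- l :* c) refl (fromℕ R) (∑ℚ loss indices) (C S) ⟩
      fromℕ R * C S - ∑ℚ loss indices * C S           ≤⟨ +-monoˡ-≤ (- (∑ℚ loss indices * C S)) counted ⟩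
      C S⁺ + ∑ℚ loss indices * C S - ∑ℚ loss indices * C S ≡⟨ solve 2 (λ x y → x :+ y :- y := x) refl (C S⁺) (∑ℚ loss indices * C S) ⟩
      C S⁺                                            ∎
      where
      open ≤-Reasoning
      counted : fromℕ R * C S ≤ C S⁺ + ∑ℚ loss indices * C S
      counted = begin
        fromℕ R * C S                                          ≤⟨ *-monoˡ-≤-nonneg (C-nonneg S) (fromℕ-mono (R≤∣L∣ v)) ⟩
        fromℕ (length (L v)) * C S                             ≡⟨ cong (fromℕ (length (L v)) *_) (C≡fromℕ S) ⟩
        fromℕ (length (L v)) * fromℕ (properCount S)           ≡⟨ fromℕ-* (length (L v)) (properCount S) ⟨
        fromℕ (length (L v) ℕ.* properCount S)                 ≤⟨ fromℕ-mono extension-bound ⟩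
        fromℕ (properCount S⁺ ℕ.+ ∑ class-total indices)       ≡⟨ fromℕ-+ (properCount S⁺) _ ⟩
        fromℕ (properCount S⁺) + fromℕ (∑ class-total indices) ≡⟨ cong (_+ fromℕ (∑ class-total indices)) (C≡fromℕ S⁺) ⟨
        C S⁺ + fromℕ (∑ class-total indices)                   ≡⟨ cong (C S⁺ +_) (fromℕ-∑ class-total indices) ⟩
        C S⁺ + ∑ℚ (fromℕ ∘ class-total) indices                ≤⟨ +-monoʳ-≤ (C S⁺) (∑ℚ-mono indices class-bound) ⟩
        C S⁺ + ∑ℚ (λ i → loss i * C S) indices                 ≡⟨ cong (C S⁺ +_) (∑ℚ-*ʳ loss (C S) indices) ⟩
        C S⁺ + ∑ℚ loss indices * C S                           ∎

  grows : ∀ S → Grows S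
  grows = All.wfRec ⊂-wellFounded 0ℓ Grows (λ S smaller v v∉S → Extension.grows-by-β S smaller v v∉S)

  1≤properCount-⊤ : 1 ℕ.≤ properCount ⊤
  1≤properCount-⊤ = fromℕ-pos⁻¹ (properCount ⊤) (subst (0ℚ <_) (C≡fromℕ ⊤) (begin-strict
    0ℚ                              <⟨ *-pos (^ℚ-pos (length (allFin n)) 0<β) 0<C⊥ ⟩
    β ^ℚ length (allFin n) * C ⊥    ≤⟨ grows-along (λ {B} _ → grows B) (allFin n) (Unique.allFin⁺ n) (λ _ → ∉⊥) (λ _ → ∈⊤) ⟩
    C (insertAll ⊥ (allFin n))      ≡⟨ cong C fill ⟩
    C ⊤                             ∎))
    where
    open ≤-Reasoning
    fill : insertAll ⊥ (allFin n) ≡ ⊤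
    fill = ⊆-antisym (λ _ → ∈⊤) (λ {x} _ → ∈-insertAll⁺ʳ (∈-allFin x))
    0<C⊥ : 0ℚ < C ⊥
    0<C⊥ = <-≤-trans (fromℕ-pos 0) (≤-trans (fromℕ-mono 1≤properCount-⊥) (≤-reflexive (sym (C≡fromℕ ⊥))))

  colouring : Σ (Fin n → ℕ) λ φ → (∀ v → φ v ∈ L v) × Distinguishing H Π φ
  colouring =
    let ψ , allowed , proper = properCount-⊤-witness 1≤properCount-⊤
    in lookup ψ , allowed , proper-⊤⇒distinguishing ψ proper

open import Defs
open import Data.Nat using (ℕ; _≤_)
open import Data.Fin using (Fin)
open import Data.List using (List; length)
open import Data.List.Membership.Propositional using (_∈_)
open import Data.List.Relation.Unary.Unique.Propositional using (Unique)
open import Data.Product using (Σ; _×_)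

theorem4p7 : (n m k : ℕ) → 2 ≤ k → (H : SeqHypergraph n m k) →
    (Δ : ℕ) → (∀ v → deg H v ≤ Δ) →
    (R : ℕ) → (L : Fin n → List ℕ) → (∀ v → Unique (L v)) → (∀ v → R ≤ length (L v)) →
    (Π : PermSet k) →
    BoundHolds H Δ (length (PermSet.perms Π)) R →
    Σ (Fin n → ℕ) λ φ → (∀ v → φ v ∈ L v) × Distinguishing H Π φ
theorem4p7 n m k _ H Δ deg≤Δ R L L-unique R≤∣L∣ Π bound = CountingArgument.colouring H Π L L-unique deg≤Δ R≤∣L∣ bound
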